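{- Let $m$ and $n$ be positive integers. Then both the longest snake path and the longest snake cycle in the fers graph of size $m \times n$ are of length $mn/3 + \mathcal{O}(m + n)$.
   Context: The fers graph of size $m\times n$ has vertex set $[0;n-1]\times[0;m-1]\subset\mathbb{Z}^2$, two cells $(x',y'),(x'',y'')$ adjacent iff $|x'-x''| = |y'-y''| = 1$. A snake path (cycle) is a path (cycle) which is an induced subgraph; length is the number of edges. The $\mathcal{O}$-term bounds the absolute value of the difference with an absolute implied constant. -}

module Defs where

open import Data.Nat using (ℕ; zero; suc; _<_; _≤_; ∣_-_∣)
open import Data.Fin using (Fin; toℕ)
open import Data.Product using (_×_; _,_)
open import Data.Sum using (_⊎_)
open import Function.Bundles using (_⇔_)
open import Relation.Binary.PropositionalEquality using (_≡_)

-- A cell (x , y) of the plane ℤ²; we only use cells with nonnegative coordinates.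
Cell : Set
Cell = ℕ × ℕ

InGrid : ℕ → ℕ → Cell → Set
InGrid m n (x , y) = (x < n) × (y < m)

Adj : Cell → Cell → Set
Adj (x₁ , y₁) (x₂ , y₂) = (∣ x₁ - x₂ ∣ ≡ 1) × (∣ y₁ - y₂ ∣ ≡ 1)

record SnakePath (m n : ℕ) : Set where
  field
    len    : ℕ
    vert   : Fin (suc len) → Cell
    inGrid : ∀ i → InGrid m n (vert i)
    inj    : ∀ i j → vert i ≡ vert j → i ≡ j
    adjIff : ∀ i j → toℕ i < toℕ j → (Adj (vert i) (vert j) ⇔ (suc (toℕ i) ≡ toℕ j))

record SnakeCycle (m n : ℕ) : Set where
  field
    len    : ℕ
    len≥3  : 3 ≤ len
    vert   : Fin len → Cell
    inGrid : ∀ i → InGrid m n (vert i)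
    inj    : ∀ i j → vert i ≡ vert j → i ≡ j
    adjIff : ∀ i j → toℕ i < toℕ j →
             (Adj (vert i) (vert j) ⇔
               ((suc (toℕ i) ≡ toℕ j) ⊎ ((toℕ i ≡ 0) × (suc (toℕ j) ≡ len))))

{-# OPTIONS --safe #-}

-- A snake only uses cells of one colour x + y mod 2, since fers moves preserve it.
-- Upper bound: a vertex of a snake path away from the border has four neighbours, at most two of them
-- on the path, so at least two free cells of its colour; a free cell is next to at most four vertices
-- of the path. For the N vertices and the W free cells of that colour this gives 2N ≤ 4W + O(m + n)
-- and N + W ≤ mn/2 + O(n), hence 3N ≤ mn + O(m + n). Deleting a vertex of a snake cycle leaves a
-- snake path.
-- Lower bound: stack blocks of six rows, each made of a zigzag to the right along two rows and a
-- zigzag back along two rows further down, so about 2n cells per block, and close the cycle with a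
-- zigzag ladder along the first two columns; this gives about mn/3 cells.
module Submission where

open import Defs
open import Data.Bool using (if_then_else_)
open import Data.Empty using (⊥)
open import Data.Fin using (Fin; zero; suc; toℕ; inject₁)
open import Data.Fin.Properties as Finₚ using (toℕ-injective; toℕ-inject₁; toℕ<n; inject₁-injective)
open import Data.List using (List; []; _∷_; length; lookup; drop)
open import Data.List.Membership.Propositional.Properties using (∈-lookup)
open import Data.List.Relation.Unary.All as All using (All; []; _∷_)
open import Data.Nat using (ℕ; zero; suc; _+_; _*_; _∸_; _≤_; _<_; z≤n; s≤s; ∣_-_∣; _≟_; _≤?_; parity)
open import Data.Nat.DivMod using (_/_; _%_; m≡m%n+[m/n]*n; m%n<n)
open import Data.Nat.Properties
open import Data.Nat.Tactic.RingSolver using (solve-∀)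
open import Algebra.Properties.Semiring.Sum +-*-semiring
  using (sum-syntax; ∑-distrib-+; ∑-comm; sum-cong-≗; *-distribˡ-sum; *-distribʳ-sum)
open import Data.Parity.Base using (Parity; 0ℙ; 1ℙ)
open import Data.Parity.Properties using () renaming (_≟_ to _≟ₚ_)
open import Data.Product using (_×_; _,_; proj₁; proj₂; uncurry; Σ-syntax; ∃-syntax)
open import Data.Product.Properties using (,-injective)
open import Data.Sum using (_⊎_; inj₁; inj₂; swap; map₁)
open import Data.Unit using (⊤)
open import Function using (_∘_; Injective)
open import Function.Bundles using (Equivalence; _⇔_; mk⇔)
open import Relation.Binary.Definitions using (DecidableEquality; tri<; tri≈; tri>)
open import Relation.Binary.PropositionalEquality
open import Relation.Nullary using (Dec; does; ¬_; contradiction; yes; no)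
open import Relation.Nullary.Decidable using (_×-dec_; map′)

private variable
  P Q R A : Set

-- Defined from does alone, so that 𝟙 (suc a ≟ suc b) and 𝟙 (a ≟ b) are definitionally equal.
𝟙 : Dec P → ℕ
𝟙 p? = if does p? then 1 else 0

𝟙-yes : (p? : Dec P) → P → 𝟙 p? ≡ 1
𝟙-yes (yes _) _ = refl
𝟙-yes (no ¬p) p = contradiction p ¬p

𝟙-no : (p? : Dec P) → ¬ P → 𝟙 p? ≡ 0
𝟙-no (yes p) ¬p = contradiction p ¬p
𝟙-no (no _) _ = refl

𝟙≤𝟙+𝟙 : (p? : Dec P) (q? : Dec Q) (r? : Dec R) → (P → Q ⊎ R) → 𝟙 p? ≤ 𝟙 q? + 𝟙 r?
𝟙≤𝟙+𝟙 (no _)  q? r? _ = z≤n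
𝟙≤𝟙+𝟙 (yes p) q? r? p⇒q⊎r with p⇒q⊎r p
... | inj₁ q = ≤-trans (≤-reflexive (sym (𝟙-yes q? q))) (m≤m+n (𝟙 q?) (𝟙 r?))
... | inj₂ r = ≤-trans (≤-reflexive (sym (𝟙-yes r? r))) (m≤n+m (𝟙 r?) (𝟙 q?))

𝟙+𝟙≤𝟙 : (p? : Dec P) (q? : Dec Q) (r? : Dec R) → (P → ¬ Q) → (P ⊎ Q → R) → 𝟙 p? + 𝟙 q? ≤ 𝟙 r?
𝟙+𝟙≤𝟙 (yes p) (yes q) r? p⇒¬q _   = contradiction q (p⇒¬q p)
𝟙+𝟙≤𝟙 (yes p) (no _)  r? _    p⊎q⇒r = ≤-reflexive (sym (𝟙-yes r? (p⊎q⇒r (inj₁ p))))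
𝟙+𝟙≤𝟙 (no _)  (yes q) r? _    p⊎q⇒r = ≤-reflexive (sym (𝟙-yes r? (p⊎q⇒r (inj₂ q))))
𝟙+𝟙≤𝟙 (no _)  (no _)  r? _    _     = z≤n

𝟙-×-dec : (p? : Dec P) (q? : Dec Q) → 𝟙 (p? ×-dec q?) ≡ 𝟙 p? * 𝟙 q?
𝟙-×-dec (yes _) (yes _) = refl
𝟙-×-dec (yes _) (no _) = refl
𝟙-×-dec (no _) _ = refl

-- The library's lemmas with the length explicit: otherwise Agda cannot infer the summands.
∑-cong : ∀ n {f g : Fin n → ℕ} → (∀ i → f i ≡ g i) → ∑[ i < n ] f i ≡ ∑[ i < n ] g i
∑-cong n = sum-cong-≗

∑-+ : ∀ n (f g : Fin n → ℕ) → ∑[ i < n ] (f i + g i) ≡ ∑[ i < n ] f i + ∑[ i < n ] g i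
∑-+ n = ∑-distrib-+ {n}

∑-*ˡ : ∀ n k (f : Fin n → ℕ) → ∑[ i < n ] (k * f i) ≡ k * ∑[ i < n ] f i
∑-*ˡ n k f = sym (*-distribˡ-sum {n} k f)

∑-*ʳ : ∀ n k (f : Fin n → ℕ) → ∑[ i < n ] (f i * k) ≡ ∑[ i < n ] f i * k
∑-*ʳ n k f = sym (*-distribʳ-sum {n} k f)

∑-swap : ∀ m n (f : Fin m → Fin n → ℕ) → ∑[ i < m ] ∑[ j < n ] f i j ≡ ∑[ j < n ] ∑[ i < m ] f i j
∑-swap m n = ∑-comm {m} {n}

∑-mono : ∀ n {f g : Fin n → ℕ} → (∀ i → f i ≤ g i) → ∑[ i < n ] f i ≤ ∑[ i < n ] g i
∑-mono zero    _   = z≤n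
∑-mono (suc n) f≤g = +-mono-≤ (f≤g zero) (∑-mono n (f≤g ∘ suc))

∑-const : ∀ n k → ∑[ i < n ] k ≡ n * k
∑-const zero    k = refl
∑-const (suc n) k = cong (k +_) (∑-const n k)

∑-zero : ∀ n {f : Fin n → ℕ} → (∀ i → f i ≡ 0) → ∑[ i < n ] f i ≡ 0
∑-zero n f≡0 = trans (∑-cong n f≡0) (trans (∑-const n 0) (*-zeroʳ n))

∑-𝟙-injective≤1 : (_≟ᴬ_ : DecidableEquality A) {N : ℕ} (f : Fin N → A) → Injective _≡_ _≡_ f →
                  ∀ a → ∑[ i < N ] 𝟙 (f i ≟ᴬ a) ≤ 1
∑-𝟙-injective≤1 _≟ᴬ_ {zero}  f inj a = z≤n
∑-𝟙-injective≤1 _≟ᴬ_ {suc N} f inj a with f zero ≟ᴬ a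
... | no _     = ∑-𝟙-injective≤1 _≟ᴬ_ (f ∘ suc) (Finₚ.suc-injective ∘ inj) a
... | yes refl = ≤-reflexive (cong suc (∑-zero N λ i → 𝟙-no (f (suc i) ≟ᴬ f zero) λ e → contradiction (inj e) λ ()))

∑-𝟙-toℕ-pair≤2 : ∀ N a b → ∑[ i < N ] (𝟙 (toℕ i ≟ a) + 𝟙 (suc (toℕ i) ≟ b)) ≤ 2
∑-𝟙-toℕ-pair≤2 N a b = begin
  ∑[ i < N ] (𝟙 (toℕ i ≟ a) + 𝟙 (suc (toℕ i) ≟ b))          ≡⟨ ∑-+ N (λ i → 𝟙 (toℕ i ≟ a)) (λ i → 𝟙 (suc (toℕ i) ≟ b)) ⟩
  ∑[ i < N ] 𝟙 (toℕ i ≟ a) + ∑[ i < N ] 𝟙 (suc (toℕ i) ≟ b) ≤⟨ +-mono-≤ (∑-𝟙-injective≤1 _≟_ {N} toℕ toℕ-injective a)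
                                                                  (∑-𝟙-injective≤1 _≟_ {N} (suc ∘ toℕ) (toℕ-injective ∘ suc-injective) b) ⟩
  2                                                        ∎
  where open ≤-Reasoning

∑-𝟙-pick : ∀ n a (g : ℕ → ℕ) → a < n → ∑[ x < n ] (𝟙 (a ≟ toℕ x) * g (toℕ x)) ≡ g a
∑-𝟙-pick (suc n) zero    g _         = trans (cong₂ _+_ (+-identityʳ (g 0)) (∑-zero n λ _ → refl)) (+-identityʳ (g 0))
∑-𝟙-pick (suc n) (suc a) g (s≤s a<n) = ∑-𝟙-pick n a (g ∘ suc) a<n

∑Grid : ℕ → ℕ → (Cell → ℕ) → ℕ
∑Grid m n h = ∑[ x < n ] ∑[ y < m ] h (toℕ x , toℕ y)

∑Grid-mono : ∀ m n {g h : Cell → ℕ} → (∀ c → g c ≤ h c) → ∑Grid m n g ≤ ∑Grid m n h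
∑Grid-mono m n g≤h = ∑-mono n λ x → ∑-mono m λ y → g≤h _

∑Grid-cong : ∀ m n {g h : Cell → ℕ} → (∀ c → g c ≡ h c) → ∑Grid m n g ≡ ∑Grid m n h
∑Grid-cong m n g≡h = ∑-cong n λ x → ∑-cong m λ y → g≡h _

∑Grid-+ : ∀ m n (g h : Cell → ℕ) → ∑Grid m n (λ c → g c + h c) ≡ ∑Grid m n g + ∑Grid m n h
∑Grid-+ m n g h = trans (∑-cong n λ x → ∑-+ m (λ y → g (toℕ x , toℕ y)) (λ y → h (toℕ x , toℕ y)))
                          (∑-+ n (λ x → ∑[ y < m ] g (toℕ x , toℕ y)) (λ x → ∑[ y < m ] h (toℕ x , toℕ y)))

∑Grid-*ˡ : ∀ m n k (h : Cell → ℕ) → ∑Grid m n (λ c → k * h c) ≡ k * ∑Grid m n h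
∑Grid-*ˡ m n k h = trans (∑-cong n λ x → ∑-*ˡ m k (λ y → h (toℕ x , toℕ y)))
                         (∑-*ˡ n k (λ x → ∑[ y < m ] h (toℕ x , toℕ y)))

∑Grid-∑-comm : ∀ m n N (h : Fin N → Cell → ℕ) →
               ∑Grid m n (λ c → ∑[ i < N ] h i c) ≡ ∑[ i < N ] ∑Grid m n (h i)
∑Grid-∑-comm m n N h = trans (∑-cong n λ x → ∑-swap m N (λ y i → h i (toℕ x , toℕ y)))
                              (∑-swap n N λ x i → ∑[ y < m ] h i (toℕ x , toℕ y))

_≟ᶜ_ : DecidableEquality Cell
(x , y) ≟ᶜ (a , b) = map′ (uncurry (cong₂ _,_)) ,-injective (x ≟ a ×-dec y ≟ b)

∑Grid-𝟙-pick : ∀ m n (g : Cell → ℕ) {a b} → a < n → b < m → ∑Grid m n (λ c → 𝟙 ((a , b) ≟ᶜ c) * g c) ≡ g (a , b)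
∑Grid-𝟙-pick m n g {a} {b} a<n b<m = begin
  ∑[ x < n ] ∑[ y < m ] (𝟙 (a ≟ toℕ x ×-dec b ≟ toℕ y) * g (toℕ x , toℕ y))
    ≡⟨ ∑-cong n (λ x → ∑-cong m λ y → factor (a ≟ toℕ x) (b ≟ toℕ y) (g (toℕ x , toℕ y))) ⟩
  ∑[ x < n ] ∑[ y < m ] (𝟙 (a ≟ toℕ x) * (𝟙 (b ≟ toℕ y) * g (toℕ x , toℕ y)))
    ≡⟨ ∑-cong n (λ x → ∑-*ˡ m (𝟙 (a ≟ toℕ x)) (λ y → 𝟙 (b ≟ toℕ y) * g (toℕ x , toℕ y))) ⟩
  ∑[ x < n ] (𝟙 (a ≟ toℕ x) * ∑[ y < m ] (𝟙 (b ≟ toℕ y) * g (toℕ x , toℕ y)))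
    ≡⟨ ∑-cong n (λ x → cong (𝟙 (a ≟ toℕ x) *_) (∑-𝟙-pick m b (λ y → g (toℕ x , y)) b<m)) ⟩
  ∑[ x < n ] (𝟙 (a ≟ toℕ x) * g (toℕ x , b))
    ≡⟨ ∑-𝟙-pick n a (λ x → g (x , b)) a<n ⟩
  g (a , b) ∎
  where
  open ≡-Reasoning
  factor : (p? : Dec P) (q? : Dec Q) (k : ℕ) → 𝟙 (p? ×-dec q?) * k ≡ 𝟙 p? * (𝟙 q? * k)
  factor p? q? k = trans (cong (_* k) (𝟙-×-dec p? q?)) (*-assoc (𝟙 p?) (𝟙 q?) k)

-- Geometry of the fers graph

∣-∣≡1⇒ : ∀ {x a} → ∣ x - a ∣ ≡ 1 → x ≡ suc a ⊎ a ≡ suc x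
∣-∣≡1⇒ {zero}  {suc a} e = inj₂ e
∣-∣≡1⇒ {suc x} {zero}  e = inj₁ e
∣-∣≡1⇒ {suc x} {suc a} e with ∣-∣≡1⇒ {x} {a} e
... | inj₁ x≡1+a = inj₁ (cong suc x≡1+a)
... | inj₂ a≡1+x = inj₂ (cong suc a≡1+x)

∣n-1+n∣≡1 : ∀ n → ∣ n - suc n ∣ ≡ 1
∣n-1+n∣≡1 zero    = refl
∣n-1+n∣≡1 (suc n) = ∣n-1+n∣≡1 n

∣1+n-n∣≡1 : ∀ n → ∣ suc n - n ∣ ≡ 1
∣1+n-n∣≡1 n = trans (∣-∣-comm (suc n) n) (∣n-1+n∣≡1 n)

adj? : ∀ c d → Dec (Adj c d)
adj? (x , y) (a , b) = ∣ x - a ∣ ≟ 1 ×-dec ∣ y - b ∣ ≟ 1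

Adj-sym : ∀ {c d} → Adj c d → Adj d c
Adj-sym {x , y} {a , b} (dx , dy) = trans (∣-∣-comm a x) dx , trans (∣-∣-comm b y) dy

Adj-irrefl : ∀ c → ¬ Adj c c
Adj-irrefl (x , y) (dx , _) = contradiction (trans (sym (m≡n⇒∣m-n∣≡0 {x} refl)) dx) λ ()

colour : Cell → Parity
colour (x , y) = parity (x + y)

colour-suc-suc : ∀ a b → colour (suc a , suc b) ≡ colour (a , b)
colour-suc-suc a b = cong (parity ∘ suc) (+-suc a b)

colour-suc-swap : ∀ a b → colour (suc a , b) ≡ colour (a , suc b)
colour-suc-swap a b = sym (cong parity (+-suc a b))

Adj⇒≡colour : ∀ {c d} → Adj c d → colour c ≡ colour d
Adj⇒≡colour {x , y} {a , b} (dx , dy) with ∣-∣≡1⇒ {x} {a} dx | ∣-∣≡1⇒ {y} {b} dy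
... | inj₁ refl | inj₁ refl = colour-suc-suc a b
... | inj₁ refl | inj₂ refl = colour-suc-swap a y
... | inj₂ refl | inj₁ refl = sym (colour-suc-swap x b)
... | inj₂ refl | inj₂ refl = sym (colour-suc-suc x y)

𝟙-parity-alternates : ∀ k p → 𝟙 (parity k ≟ₚ p) + 𝟙 (parity (suc k) ≟ₚ p) ≡ 1
𝟙-parity-alternates zero    0ℙ = refl
𝟙-parity-alternates zero    1ℙ = refl
𝟙-parity-alternates (suc k) p  = trans (+-comm (𝟙 (parity (suc k) ≟ₚ p)) _) (𝟙-parity-alternates k p)

∑-alternating≤ : ∀ m (f : ℕ → ℕ) → (∀ y → f y + f (suc y) ≤ 1) → 2 * ∑[ y < m ] f (toℕ y) ≤ suc m
∑-alternating≤ zero          f alt = z≤n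
∑-alternating≤ (suc zero)    f alt = *-monoʳ-≤ 2 (≤-trans (≤-reflexive (+-identityʳ (f 0))) (≤-trans (m≤m+n (f 0) (f 1)) (alt 0)))
∑-alternating≤ (suc (suc m)) f alt = begin
  2 * (f 0 + (f 1 + ∑[ y < m ] f (2 + toℕ y)))   ≡⟨ regroup (f 0) (f 1) (∑[ y < m ] f (2 + toℕ y)) ⟩
  2 * (f 0 + f 1) + 2 * ∑[ y < m ] f (2 + toℕ y) ≤⟨ +-mono-≤ (*-monoʳ-≤ 2 (alt 0)) (∑-alternating≤ m (f ∘ (2 +_)) (alt ∘ (2 +_))) ⟩
  2 + suc m                                      ∎
  where
  open ≤-Reasoning
  regroup : ∀ a b s → 2 * (a + (b + s)) ≡ 2 * (a + b) + 2 * s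
  regroup = solve-∀

∑-𝟙-hit : ∀ n a → a < n → ∑[ x < n ] 𝟙 (a ≟ toℕ x) ≡ 1
∑-𝟙-hit n a a<n = trans (∑-cong n λ x → sym (*-identityʳ (𝟙 (a ≟ toℕ x)))) (∑-𝟙-pick n a (λ _ → 1) a<n)

∑-𝟙-distance1≤2 : ∀ n a → ∑[ x < n ] 𝟙 (∣ a - toℕ x ∣ ≟ 1) ≤ 2
∑-𝟙-distance1≤2 n a = ≤-trans (∑-mono n λ x → hits (toℕ x)) (∑-𝟙-toℕ-pair≤2 n (suc a) a)
  where
  hits : ∀ x → 𝟙 (∣ a - x ∣ ≟ 1) ≤ 𝟙 (x ≟ suc a) + 𝟙 (suc x ≟ a)
  hits x = 𝟙≤𝟙+𝟙 (∣ a - x ∣ ≟ 1) (x ≟ suc a) (suc x ≟ a) (swap ∘ map₁ sym ∘ ∣-∣≡1⇒ {a} {x})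

∑-𝟙-distance1≥2 : ∀ n a → 2 + a < n → 2 ≤ ∑[ x < n ] 𝟙 (∣ toℕ x - suc a ∣ ≟ 1)
∑-𝟙-distance1≥2 n a 2+a<n = begin
  2                                                       ≡⟨ cong₂ _+_ (sym (∑-𝟙-hit n a (<-trans (n<1+n a) (<-trans (n<1+n (suc a)) 2+a<n))))
                                                                        (sym (∑-𝟙-hit n (2 + a) 2+a<n)) ⟩
  ∑[ x < n ] 𝟙 (a ≟ toℕ x) + ∑[ x < n ] 𝟙 (2 + a ≟ toℕ x)
                                                          ≡⟨ sym (∑-+ n (λ x → 𝟙 (a ≟ toℕ x)) (λ x → 𝟙 (2 + a ≟ toℕ x))) ⟩
  ∑[ x < n ] (𝟙 (a ≟ toℕ x) + 𝟙 (2 + a ≟ toℕ x))          ≤⟨ ∑-mono n (λ x → hits (toℕ x)) ⟩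
  ∑[ x < n ] 𝟙 (∣ toℕ x - suc a ∣ ≟ 1)                    ∎
  where
  open ≤-Reasoning
  hits : ∀ x → 𝟙 (a ≟ x) + 𝟙 (2 + a ≟ x) ≤ 𝟙 (∣ x - suc a ∣ ≟ 1)
  hits x = 𝟙+𝟙≤𝟙 (a ≟ x) (2 + a ≟ x) (∣ x - suc a ∣ ≟ 1) (λ { refl 2+a≡a → m≢1+n+m a (sym 2+a≡a) })
             λ { (inj₁ refl) → ∣n-1+n∣≡1 a ; (inj₂ refl) → ∣1+n-n∣≡1 a }

∑Grid-separable : ∀ m n (f g : ℕ → ℕ) →
                  ∑Grid m n (λ c → f (proj₁ c) * g (proj₂ c)) ≡ ∑[ x < n ] f (toℕ x) * ∑[ y < m ] g (toℕ y)
∑Grid-separable m n f g = trans (∑-cong n λ x → ∑-*ˡ m (f (toℕ x)) (λ y → g (toℕ y)))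
                                (∑-*ʳ n (∑[ y < m ] g (toℕ y)) (λ x → f (toℕ x)))

∑Grid-neighbours≤4 : ∀ m n c → ∑Grid m n (λ d → 𝟙 (adj? c d)) ≤ 4
∑Grid-neighbours≤4 m n (a , b) = begin
  ∑Grid m n (λ d → 𝟙 (adj? (a , b) d))
    ≡⟨ ∑Grid-cong m n (λ d → 𝟙-×-dec (∣ a - proj₁ d ∣ ≟ 1) (∣ b - proj₂ d ∣ ≟ 1)) ⟩
  ∑Grid m n (λ d → 𝟙 (∣ a - proj₁ d ∣ ≟ 1) * 𝟙 (∣ b - proj₂ d ∣ ≟ 1))
    ≡⟨ ∑Grid-separable m n (λ x → 𝟙 (∣ a - x ∣ ≟ 1)) (λ y → 𝟙 (∣ b - y ∣ ≟ 1)) ⟩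
  ∑[ x < n ] 𝟙 (∣ a - toℕ x ∣ ≟ 1) * ∑[ y < m ] 𝟙 (∣ b - toℕ y ∣ ≟ 1)
    ≤⟨ *-mono-≤ (∑-𝟙-distance1≤2 n a) (∑-𝟙-distance1≤2 m b) ⟩
  4 ∎
  where open ≤-Reasoning

∑Grid-interior-neighbours≥4 : ∀ m n a b → 2 + a < n → 2 + b < m → 4 ≤ ∑Grid m n (λ c → 𝟙 (adj? c (suc a , suc b)))
∑Grid-interior-neighbours≥4 m n a b 2+a<n 2+b<m = begin
  4 ≤⟨ *-mono-≤ (∑-𝟙-distance1≥2 n a 2+a<n) (∑-𝟙-distance1≥2 m b 2+b<m) ⟩
  ∑[ x < n ] 𝟙 (∣ toℕ x - suc a ∣ ≟ 1) * ∑[ y < m ] 𝟙 (∣ toℕ y - suc b ∣ ≟ 1)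
    ≡⟨ sym (∑Grid-separable m n (λ x → 𝟙 (∣ x - suc a ∣ ≟ 1)) (λ y → 𝟙 (∣ y - suc b ∣ ≟ 1))) ⟩
  ∑Grid m n (λ c → 𝟙 (∣ proj₁ c - suc a ∣ ≟ 1) * 𝟙 (∣ proj₂ c - suc b ∣ ≟ 1))
    ≡⟨ sym (∑Grid-cong m n λ c → 𝟙-×-dec (∣ proj₁ c - suc a ∣ ≟ 1) (∣ proj₂ c - suc b ∣ ≟ 1)) ⟩
  ∑Grid m n (λ c → 𝟙 (adj? c (suc a , suc b))) ∎
  where open ≤-Reasoning

edge : ℕ → ℕ → ℕ
edge k a = 𝟙 (a ≟ 0) + 𝟙 (suc a ≟ k)

border : ℕ → ℕ → Cell → ℕ
border m n (a , b) = edge n a + edge m b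

edge-or-inner : ∀ k a → a < k → 1 ≤ edge k a ⊎ Σ[ a′ ∈ ℕ ] (a ≡ suc a′ × 2 + a′ < k)
edge-or-inner k zero    _   = inj₁ (s≤s z≤n)
edge-or-inner k (suc a) a<k with suc (suc a) ≟ k
... | yes 2+a≡k = inj₁ (≤-reflexive (sym (𝟙-yes (suc (suc a) ≟ k) 2+a≡k)))
... | no  2+a≢k = inj₂ (a , refl , ≤∧≢⇒< a<k 2+a≢k)

∑Grid-border≤ : ∀ m n → ∑Grid m n (border m n) ≤ m * 2 + n * 2
∑Grid-border≤ m n = begin
  ∑[ x < n ] ∑[ y < m ] (edge n (toℕ x) + edge m (toℕ y))
    ≡⟨ ∑-cong n (λ x → ∑-+ m (λ _ → edge n (toℕ x)) (λ y → edge m (toℕ y))) ⟩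
  ∑[ x < n ] (∑[ y < m ] edge n (toℕ x) + ∑[ y < m ] edge m (toℕ y))
    ≡⟨ ∑-+ n (λ x → ∑[ y < m ] edge n (toℕ x)) (λ _ → ∑[ y < m ] edge m (toℕ y)) ⟩
  ∑[ x < n ] ∑[ y < m ] edge n (toℕ x) + ∑[ x < n ] ∑[ y < m ] edge m (toℕ y)
    ≡⟨ cong₂ _+_ (trans (∑-cong n λ x → ∑-const m (edge n (toℕ x))) (∑-*ˡ n m (λ x → edge n (toℕ x))))
                 (∑-const n (∑[ y < m ] edge m (toℕ y))) ⟩
  m * ∑[ x < n ] edge n (toℕ x) + n * ∑[ y < m ] edge m (toℕ y)
    ≤⟨ +-mono-≤ (*-monoʳ-≤ m (∑-𝟙-toℕ-pair≤2 n 0 n)) (*-monoʳ-≤ n (∑-𝟙-toℕ-pair≤2 m 0 m)) ⟩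
  m * 2 + n * 2 ∎
  where open ≤-Reasoning

∑Grid-colourClass≤ : ∀ m n p → 2 * ∑Grid m n (λ c → 𝟙 (colour c ≟ₚ p)) ≤ n * suc m
∑Grid-colourClass≤ m n p = begin
  2 * ∑[ x < n ] ∑[ y < m ] 𝟙 (parity (toℕ x + toℕ y) ≟ₚ p)
    ≡⟨ sym (∑-*ˡ n 2 (λ x → ∑[ y < m ] 𝟙 (parity (toℕ x + toℕ y) ≟ₚ p))) ⟩
  ∑[ x < n ] (2 * ∑[ y < m ] 𝟙 (parity (toℕ x + toℕ y) ≟ₚ p))
    ≤⟨ ∑-mono n (λ x → ∑-alternating≤ m (λ y → 𝟙 (parity (toℕ x + y) ≟ₚ p)) (alternates (toℕ x))) ⟩
  ∑[ x < n ] suc m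
    ≡⟨ ∑-const n (suc m) ⟩
  n * suc m ∎
  where
  open ≤-Reasoning
  alternates : ∀ x y → 𝟙 (parity (x + y) ≟ₚ p) + 𝟙 (parity (x + suc y) ≟ₚ p) ≤ 1
  alternates x y = subst (λ k → 𝟙 (parity (x + y) ≟ₚ p) + 𝟙 (parity k ≟ₚ p) ≤ 1) (sym (+-suc x y))
                         (≤-reflexive (𝟙-parity-alternates (x + y) p))

constant-along-steps : ∀ {B : Set} k (g : Fin (suc k) → B) → (∀ j → g (inject₁ j) ≡ g (suc j)) → ∀ i → g i ≡ g zero
constant-along-steps k       g step zero    = refl
constant-along-steps (suc k) g step (suc i) = trans (constant-along-steps k (g ∘ suc) (step ∘ suc) i) (sym (step zero))

k≤free*k+occupied*k : ∀ o k → k ≤ 𝟙 (o ≟ 0) * k + o * k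
k≤free*k+occupied*k zero    k = ≤-reflexive (sym (trans (+-identityʳ (k + 0)) (+-identityʳ k)))
k≤free*k+occupied*k (suc o) k = m≤m+n k (o * k)

free+occupied≤1 : ∀ o → o ≤ 1 → 𝟙 (o ≟ 0) * 1 + o * 1 ≤ 1
free+occupied≤1 zero       _ = ≤-refl
free+occupied≤1 (suc zero) _ = ≤-refl
free+occupied≤1 (suc (suc o)) (s≤s ())

-- Upper bound by double counting

double-counting-arith : ∀ {N T B W C q} → 2 * N ≤ T + 2 * B → T ≤ 4 * W → W + N ≤ C → 2 * C ≤ q → 3 * N ≤ q + B
double-counting-arith {N} {T} {B} {W} {C} {q} 2N≤T+2B T≤4W W+N≤C 2C≤q = *-cancelˡ-≤ 2 (begin
  2 * (3 * N)         ≡⟨ regroup₁ N ⟩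
  4 * N + 2 * N       ≤⟨ +-monoʳ-≤ (4 * N) (≤-trans 2N≤T+2B (+-monoˡ-≤ (2 * B) T≤4W)) ⟩
  4 * N + (4 * W + 2 * B) ≡⟨ regroup₂ N W B ⟩
  4 * (W + N) + 2 * B ≤⟨ +-monoˡ-≤ (2 * B) (*-monoʳ-≤ 4 W+N≤C) ⟩
  4 * C + 2 * B       ≤⟨ +-monoˡ-≤ (2 * B) (≤-trans (≤-reflexive (regroup₃ C)) (*-monoʳ-≤ 2 2C≤q)) ⟩
  2 * q + 2 * B       ≡⟨ sym (*-distribˡ-+ 2 q B) ⟩
  2 * (q + B)         ∎)
  where
  open ≤-Reasoning
  regroup₁ : ∀ N → 2 * (3 * N) ≡ 4 * N + 2 * N
  regroup₁ = solve-∀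
  regroup₂ : ∀ N W B → 4 * N + (4 * W + 2 * B) ≡ 4 * (W + N) + 2 * B
  regroup₂ = solve-∀
  regroup₃ : ∀ C → 4 * C ≡ 2 * (2 * C)
  regroup₃ = solve-∀

module PathBound {m n : ℕ} (P : SnakePath m n) where
  open SnakePath P

  occupancy : Cell → ℕ
  occupancy c = ∑[ i < suc len ] 𝟙 (vert i ≟ᶜ c)

  free : Cell → ℕ
  free c = 𝟙 (occupancy c ≟ 0)

  occupancy≤1 : ∀ c → occupancy c ≤ 1
  occupancy≤1 = ∑-𝟙-injective≤1 _≟ᶜ_ vert (inj _ _)

  occupancy*k≤k : ∀ c k → occupancy c * k ≤ k
  occupancy*k≤k c k = ≤-trans (*-monoˡ-≤ k (occupancy≤1 c)) (≤-reflexive (+-identityʳ k))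

  ∑Grid-occupancy : ∀ g → ∑Grid m n (λ c → occupancy c * g c) ≡ ∑[ i < suc len ] g (vert i)
  ∑Grid-occupancy g = begin
    ∑Grid m n (λ c → occupancy c * g c)
      ≡⟨ ∑Grid-cong m n (λ c → sym (∑-*ʳ (suc len) (g c) λ i → 𝟙 (vert i ≟ᶜ c))) ⟩
    ∑Grid m n (λ c → ∑[ i < suc len ] (𝟙 (vert i ≟ᶜ c) * g c))
      ≡⟨ ∑Grid-∑-comm m n (suc len) (λ i c → 𝟙 (vert i ≟ᶜ c) * g c) ⟩
    ∑[ i < suc len ] ∑Grid m n (λ c → 𝟙 (vert i ≟ᶜ c) * g c)
      ≡⟨ ∑-cong (suc len) pick ⟩
    ∑[ i < suc len ] g (vert i) ∎
    where
    open ≡-Reasoning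
    pick : ∀ i → ∑Grid m n (λ c → 𝟙 (vert i ≟ᶜ c) * g c) ≡ g (vert i)
    pick i = ∑Grid-𝟙-pick m n g (proj₁ (inGrid i)) (proj₂ (inGrid i))

  consecutive-adjacent : ∀ j → Adj (vert (inject₁ j)) (vert (suc j))
  consecutive-adjacent j = Equivalence.from (adjIff (inject₁ j) (suc j) (s≤s (≤-reflexive (toℕ-inject₁ j))))
                                            (cong suc (toℕ-inject₁ j))

  pathColour : Parity
  pathColour = colour (vert zero)

  colour-vert : ∀ i → colour (vert i) ≡ pathColour
  colour-vert = constant-along-steps len (colour ∘ vert) (λ j → Adj⇒≡colour {vert (inject₁ j)} {vert (suc j)} (consecutive-adjacent j))

  pathNeighbours≤2 : ∀ i → ∑[ j < suc len ] 𝟙 (adj? (vert j) (vert i)) ≤ 2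
  pathNeighbours≤2 i =
    ≤-trans (∑-mono (suc len) λ j → 𝟙≤𝟙+𝟙 (adj? (vert j) (vert i)) (toℕ j ≟ suc (toℕ i)) (suc (toℕ j) ≟ toℕ i) (neighbour j))
            (∑-𝟙-toℕ-pair≤2 (suc len) (suc (toℕ i)) (toℕ i))
    where
    neighbour : ∀ j → Adj (vert j) (vert i) → toℕ j ≡ suc (toℕ i) ⊎ suc (toℕ j) ≡ toℕ i
    neighbour j adj with <-cmp (toℕ j) (toℕ i)
    ... | tri< j<i _ _ = inj₂ (Equivalence.to (adjIff j i j<i) adj)
    ... | tri≈ _ j≡i _ = contradiction (subst (λ k → Adj (vert k) (vert i)) (toℕ-injective j≡i) adj) (Adj-irrefl (vert i))
    ... | tri> _ _ i<j = inj₁ (sym (Equivalence.to (adjIff i j i<j) (Adj-sym {vert j} {vert i} adj)))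

  freeNeighbours : Cell → ℕ
  freeNeighbours v = ∑Grid m n (λ c → free c * 𝟙 (adj? c v))

  interior-freeNeighbours≥2 : ∀ a b → 2 + a < n → 2 + b < m →
                              ∑[ j < suc len ] 𝟙 (adj? (vert j) (suc a , suc b)) ≤ 2 → 2 ≤ freeNeighbours (suc a , suc b)
  interior-freeNeighbours≥2 a b 2+a<n 2+b<m onPath≤2 = +-cancelʳ-≤ 2 2 (freeNeighbours v) (begin
    4                                                        ≤⟨ ∑Grid-interior-neighbours≥4 m n a b 2+a<n 2+b<m ⟩
    ∑Grid m n (λ c → 𝟙 (adj? c v))                           ≤⟨ ∑Grid-mono m n (λ c → k≤free*k+occupied*k (occupancy c) (𝟙 (adj? c v))) ⟩
    ∑Grid m n (λ c → free c * 𝟙 (adj? c v) + occupancy c * 𝟙 (adj? c v))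
      ≡⟨ ∑Grid-+ m n (λ c → free c * 𝟙 (adj? c v)) (λ c → occupancy c * 𝟙 (adj? c v)) ⟩
    freeNeighbours v + ∑Grid m n (λ c → occupancy c * 𝟙 (adj? c v))
      ≡⟨ cong (freeNeighbours v +_) (∑Grid-occupancy (λ c → 𝟙 (adj? c v))) ⟩
    freeNeighbours v + ∑[ j < suc len ] 𝟙 (adj? (vert j) v) ≤⟨ +-monoʳ-≤ (freeNeighbours v) onPath≤2 ⟩
    freeNeighbours v + 2                                     ∎)
    where
    open ≤-Reasoning
    v : Cell
    v = (suc a , suc b)

  freeNeighbours+border≥2 : ∀ i → 2 ≤ freeNeighbours (vert i) + 2 * border m n (vert i)
  freeNeighbours+border≥2 i = atCell (vert i) (inGrid i) (pathNeighbours≤2 i)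
    where
    atCell : ∀ v → InGrid m n v → ∑[ j < suc len ] 𝟙 (adj? (vert j) v) ≤ 2 → 2 ≤ freeNeighbours v + 2 * border m n v
    atCell (a , b) (a<n , b<m) onPath≤2 with edge-or-inner n a a<n | edge-or-inner m b b<m
    ... | inj₁ 1≤edge | _ = ≤-trans (*-monoʳ-≤ 2 (≤-trans 1≤edge (m≤m+n (edge n a) (edge m b))))
                                    (m≤n+m (2 * border m n (a , b)) (freeNeighbours (a , b)))
    ... | inj₂ _ | inj₁ 1≤edge = ≤-trans (*-monoʳ-≤ 2 (≤-trans 1≤edge (m≤n+m (edge m b) (edge n a))))
                                         (m≤n+m (2 * border m n (a , b)) (freeNeighbours (a , b)))
    ... | inj₂ (a′ , refl , 2+a′<n) | inj₂ (b′ , refl , 2+b′<m) =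
      ≤-trans (interior-freeNeighbours≥2 a′ b′ 2+a′<n 2+b′<m onPath≤2)
              (m≤m+n (freeNeighbours (suc a′ , suc b′)) (2 * border m n (suc a′ , suc b′)))

  sameColour : Cell → ℕ
  sameColour c = 𝟙 (colour c ≟ₚ pathColour)

  pathNeighboursOf≤4 : ∀ c → ∑[ i < suc len ] 𝟙 (adj? c (vert i)) ≤ 4 * sameColour c
  pathNeighboursOf≤4 c = bound (colour c ≟ₚ pathColour)
    where
    bound : (same? : Dec (colour c ≡ pathColour)) → ∑[ i < suc len ] 𝟙 (adj? c (vert i)) ≤ 4 * 𝟙 same?
    bound (yes _) = begin
      ∑[ i < suc len ] 𝟙 (adj? c (vert i))      ≡⟨ sym (∑Grid-occupancy (λ d → 𝟙 (adj? c d))) ⟩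
      ∑Grid m n (λ d → occupancy d * 𝟙 (adj? c d)) ≤⟨ ∑Grid-mono m n (λ d → occupancy*k≤k d (𝟙 (adj? c d))) ⟩
      ∑Grid m n (λ d → 𝟙 (adj? c d))              ≤⟨ ∑Grid-neighbours≤4 m n c ⟩
      4                                           ∎
      where open ≤-Reasoning
    bound (no different) = ≤-reflexive (∑-zero (suc len) λ i →
      𝟙-no (adj? c (vert i)) λ adj → different (trans (Adj⇒≡colour {c} {vert i} adj) (colour-vert i)))

  freeOfColour : ℕ
  freeOfColour = ∑Grid m n (λ c → free c * sameColour c)

  ∑freeNeighbours≤ : ∑[ i < suc len ] freeNeighbours (vert i) ≤ 4 * freeOfColour
  ∑freeNeighbours≤ = begin
    ∑[ i < suc len ] ∑Grid m n (λ c → free c * 𝟙 (adj? c (vert i)))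
      ≡⟨ sym (∑Grid-∑-comm m n (suc len) (λ i c → free c * 𝟙 (adj? c (vert i)))) ⟩
    ∑Grid m n (λ c → ∑[ i < suc len ] (free c * 𝟙 (adj? c (vert i))))
      ≡⟨ ∑Grid-cong m n (λ c → ∑-*ˡ (suc len) (free c) (λ i → 𝟙 (adj? c (vert i)))) ⟩
    ∑Grid m n (λ c → free c * ∑[ i < suc len ] 𝟙 (adj? c (vert i)))
      ≤⟨ ∑Grid-mono m n (λ c → *-monoʳ-≤ (free c) (pathNeighboursOf≤4 c)) ⟩
    ∑Grid m n (λ c → free c * (4 * sameColour c))
      ≡⟨ ∑Grid-cong m n (λ c → *-comm-middle (free c) (sameColour c)) ⟩
    ∑Grid m n (λ c → 4 * (free c * sameColour c))
      ≡⟨ ∑Grid-*ˡ m n 4 (λ c → free c * sameColour c) ⟩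
    4 * freeOfColour ∎
    where
    open ≤-Reasoning
    *-comm-middle : ∀ a b → a * (4 * b) ≡ 4 * (a * b)
    *-comm-middle = solve-∀

  freeOfColour+length≤ : freeOfColour + suc len ≤ ∑Grid m n sameColour
  freeOfColour+length≤ = begin
    freeOfColour + suc len
      ≡⟨ cong (freeOfColour +_) (sym (trans (∑Grid-occupancy (λ _ → 1)) (trans (∑-const (suc len) 1) (*-identityʳ (suc len))))) ⟩
    freeOfColour + ∑Grid m n (λ c → occupancy c * 1)
      ≡⟨ sym (∑Grid-+ m n (λ c → free c * sameColour c) (λ c → occupancy c * 1)) ⟩
    ∑Grid m n (λ c → free c * sameColour c + occupancy c * 1)
      ≤⟨ ∑Grid-mono m n (λ c → pointwise c (colour c ≟ₚ pathColour)) ⟩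
    ∑Grid m n sameColour ∎
    where
    open ≤-Reasoning
    pointwise : ∀ c (same? : Dec (colour c ≡ pathColour)) → free c * 𝟙 same? + occupancy c * 1 ≤ 𝟙 same?
    pointwise c (yes _) = free+occupied≤1 (occupancy c) (occupancy≤1 c)
    pointwise c (no different) = ≤-reflexive (begin-equality
      free c * 0 + occupancy c * 1 ≡⟨ cong₂ _+_ (*-zeroʳ (free c)) (*-identityʳ (occupancy c)) ⟩
      occupancy c                  ≡⟨ ∑-zero (suc len) (λ i → 𝟙-no (vert i ≟ᶜ c) (vᵢ≢c i)) ⟩
      0                            ∎)
      where
      vᵢ≢c : ∀ i → vert i ≢ c
      vᵢ≢c i vᵢ≡c = different (trans (cong colour (sym vᵢ≡c)) (colour-vert i))

  length-upperBound : 3 * len ≤ m * n + 3 * (m + n)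
  length-upperBound = begin
    3 * len                   ≤⟨ *-monoʳ-≤ 3 (n≤1+n len) ⟩
    3 * suc len               ≤⟨ double-counting-arith {W = freeOfColour} {C = ∑Grid m n sameColour}
                                   2N≤T+2B ∑freeNeighbours≤ freeOfColour+length≤ (∑Grid-colourClass≤ m n pathColour) ⟩
    n * suc m + ∑[ i < suc len ] border m n (vert i) ≤⟨ +-monoʳ-≤ (n * suc m) ∑border≤ ⟩
    n * suc m + (m * 2 + n * 2) ≡⟨ regroup m n ⟩
    m * n + (2 * m + 3 * n)   ≤⟨ +-monoʳ-≤ (m * n) (+-monoˡ-≤ (3 * n) (*-monoˡ-≤ m (n≤1+n 2))) ⟩
    m * n + (3 * m + 3 * n)   ≡⟨ cong (m * n +_) (sym (*-distribˡ-+ 3 m n)) ⟩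
    m * n + 3 * (m + n)       ∎
    where
    open ≤-Reasoning
    regroup : ∀ m n → n * suc m + (m * 2 + n * 2) ≡ m * n + (2 * m + 3 * n)
    regroup = solve-∀
    2N≤T+2B : 2 * suc len ≤ ∑[ i < suc len ] freeNeighbours (vert i) + 2 * ∑[ i < suc len ] border m n (vert i)
    2N≤T+2B = begin
      2 * suc len ≡⟨ *-comm 2 (suc len) ⟩
      suc len * 2 ≡⟨ sym (∑-const (suc len) 2) ⟩
      ∑[ i < suc len ] 2 ≤⟨ ∑-mono (suc len) freeNeighbours+border≥2 ⟩
      ∑[ i < suc len ] (freeNeighbours (vert i) + 2 * border m n (vert i))
        ≡⟨ ∑-+ (suc len) (λ i → freeNeighbours (vert i)) (λ i → 2 * border m n (vert i)) ⟩
      ∑[ i < suc len ] freeNeighbours (vert i) + ∑[ i < suc len ] (2 * border m n (vert i))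
        ≡⟨ cong (∑[ i < suc len ] freeNeighbours (vert i) +_) (∑-*ˡ (suc len) 2 (λ i → border m n (vert i))) ⟩
      ∑[ i < suc len ] freeNeighbours (vert i) + 2 * ∑[ i < suc len ] border m n (vert i) ∎
    ∑border≤ : ∑[ i < suc len ] border m n (vert i) ≤ m * 2 + n * 2
    ∑border≤ = begin
      ∑[ i < suc len ] border m n (vert i) ≡⟨ sym (∑Grid-occupancy (border m n)) ⟩
      ∑Grid m n (λ c → occupancy c * border m n c)
        ≤⟨ ∑Grid-mono m n (λ c → occupancy*k≤k c (border m n c)) ⟩
      ∑Grid m n (border m n) ≤⟨ ∑Grid-border≤ m n ⟩
      m * 2 + n * 2 ∎

cycle⇒path : ∀ {m n} (Q : SnakeCycle m n) → Σ[ P ∈ SnakePath m n ] SnakeCycle.len Q ≡ 2 + SnakePath.len P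
cycle⇒path record { len = suc (suc (suc k)) ; len≥3 = s≤s (s≤s (s≤s _))
                  ; vert = vert ; inGrid = inGrid ; inj = inj ; adjIff = adjIff } =
  record
    { len    = suc k
    ; vert   = vert ∘ inject₁
    ; inGrid = inGrid ∘ inject₁
    ; inj    = λ i j e → inject₁-injective (inj (inject₁ i) (inject₁ j) e)
    ; adjIff = adjIff′
    } , refl
  where
  adjIff′ : ∀ i j → toℕ i < toℕ j → Adj (vert (inject₁ i)) (vert (inject₁ j)) ⇔ (suc (toℕ i) ≡ toℕ j)
  adjIff′ i j i<j = mk⇔ to from
    where
    cyclic : Adj (vert (inject₁ i)) (vert (inject₁ j)) ⇔
             (suc (toℕ (inject₁ i)) ≡ toℕ (inject₁ j) ⊎ (toℕ (inject₁ i) ≡ 0 × suc (toℕ (inject₁ j)) ≡ 3 + k))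
    cyclic = adjIff (inject₁ i) (inject₁ j) (subst₂ _<_ (sym (toℕ-inject₁ i)) (sym (toℕ-inject₁ j)) i<j)
    to : Adj (vert (inject₁ i)) (vert (inject₁ j)) → suc (toℕ i) ≡ toℕ j
    to adj with Equivalence.to cyclic adj
    ... | inj₁ e       = subst₂ (λ a b → suc a ≡ b) (toℕ-inject₁ i) (toℕ-inject₁ j) e
    ... | inj₂ (_ , e) = contradiction (trans (sym (toℕ-inject₁ j)) (suc-injective e)) (<⇒≢ (toℕ<n j))
    from : suc (toℕ i) ≡ toℕ j → Adj (vert (inject₁ i)) (vert (inject₁ j))
    from e = Equivalence.from cyclic (inj₁ (subst₂ (λ a b → suc a ≡ b) (sym (toℕ-inject₁ i)) (sym (toℕ-inject₁ j)) e))

-- Snakes as lists of cells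

Apart : Cell → Cell → Set
Apart c d = c ≢ d × ¬ Adj c d

Prependable : Cell → List Cell → Set
Prependable a []      = ⊤
Prependable a (b ∷ L) = Adj a b × All (Apart a) L

Snake : List Cell → Set
Snake []      = ⊤
Snake (a ∷ L) = Snake L × Prependable a L

Closes : Cell → List Cell → Set
Closes v []          = ⊥
Closes v (e ∷ [])    = Adj v e
Closes v (c ∷ d ∷ L) = Apart v c × Closes v (d ∷ L)

Adj⇒≢ : ∀ {c d} → Adj c d → c ≢ d
Adj⇒≢ {c} adj refl = Adj-irrefl c adj

snake-injective : ∀ L → Snake L → ∀ i j → lookup L i ≡ lookup L j → i ≡ j
snake-injective (a ∷ L)     _                zero          zero          _ = refl
snake-injective (a ∷ L)     (snake , _)      (suc i)       (suc j)       e = cong suc (snake-injective L snake i j e)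
snake-injective (a ∷ b ∷ L) (_ , adj , _)    zero          (suc zero)    e = contradiction e (Adj⇒≢ {a} {b} adj)
snake-injective (a ∷ b ∷ L) (_ , adj , _)    (suc zero)    zero          e = contradiction (sym e) (Adj⇒≢ {a} {b} adj)
snake-injective (a ∷ b ∷ L) (_ , _ , apart)  zero          (suc (suc j)) e = contradiction e (proj₁ (All.lookup apart (∈-lookup j)))
snake-injective (a ∷ b ∷ L) (_ , _ , apart)  (suc (suc i)) zero          e = contradiction (sym e) (proj₁ (All.lookup apart (∈-lookup i)))

snake-adjIff : ∀ L → Snake L → ∀ i j → toℕ i < toℕ j → Adj (lookup L i) (lookup L j) ⇔ (suc (toℕ i) ≡ toℕ j)
snake-adjIff (a ∷ b ∷ L) (_ , adj , _)   zero    (suc zero)    _ = mk⇔ (λ _ → refl) (λ _ → adj)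
snake-adjIff (a ∷ b ∷ L) (_ , _ , apart) zero    (suc (suc j)) _ =
  mk⇔ (λ adj → contradiction adj (proj₂ (All.lookup apart (∈-lookup j)))) λ ()
snake-adjIff (a ∷ L)     (snake , _)     (suc i) (suc j) (s≤s i<j) =
  mk⇔ (cong suc ∘ Equivalence.to (snake-adjIff L snake i j i<j)) (Equivalence.from (snake-adjIff L snake i j i<j) ∘ suc-injective)

closes-lookup : ∀ v L → Closes v L → ∀ j → v ≢ lookup L j × (Adj v (lookup L j) ⇔ (suc (toℕ j) ≡ length L))
closes-lookup v (e ∷ [])    adj           zero    = Adj⇒≢ {v} {e} adj , mk⇔ (λ _ → refl) (λ _ → adj)
closes-lookup v (c ∷ d ∷ L) (apart , _)   zero    = proj₁ apart , mk⇔ (λ adj → contradiction adj (proj₂ apart)) λ ()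
closes-lookup v (c ∷ d ∷ L) (_ , closes)  (suc j) with closes-lookup v (d ∷ L) closes j
... | v≢ , adj⇔ = v≢ , mk⇔ (cong suc ∘ Equivalence.to adj⇔) (Equivalence.from adj⇔ ∘ suc-injective)

snakeCycle : ∀ {m n} v s L → Snake (s ∷ L) → Adj v s → Closes v L → All (InGrid m n) (v ∷ s ∷ L) →
             Σ[ Q ∈ SnakeCycle m n ] SnakeCycle.len Q ≡ 2 + length L
snakeCycle {m} {n} v s L@(_ ∷ _) snake adj closes inGrid = record
  { len    = 2 + length L
  ; len≥3  = s≤s (s≤s (s≤s z≤n))
  ; vert   = lookup (v ∷ s ∷ L)
  ; inGrid = All.lookup inGrid ∘ ∈-lookup
  ; inj    = injective
  ; adjIff = adjIff
  } , refl
  where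
  v≢ : ∀ j → v ≢ lookup (s ∷ L) j
  v≢ zero    = Adj⇒≢ {v} {s} adj
  v≢ (suc j) = proj₁ (closes-lookup v L closes j)
  injective : ∀ i j → lookup (v ∷ s ∷ L) i ≡ lookup (v ∷ s ∷ L) j → i ≡ j
  injective zero    zero    _ = refl
  injective zero    (suc j) e = contradiction e (v≢ j)
  injective (suc i) zero    e = contradiction (sym e) (v≢ i)
  injective (suc i) (suc j) e = cong suc (snake-injective (s ∷ L) snake i j e)
  adjIff : ∀ i j → toℕ i < toℕ j → Adj (lookup (v ∷ s ∷ L) i) (lookup (v ∷ s ∷ L) j) ⇔
           (suc (toℕ i) ≡ toℕ j ⊎ (toℕ i ≡ 0 × suc (toℕ j) ≡ 2 + length L))
  adjIff zero    (suc zero)    _ = mk⇔ (λ _ → inj₁ refl) (λ _ → adj)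
  adjIff zero    (suc (suc j)) _ = mk⇔ (λ a → inj₂ (refl , cong (2 +_) (Equivalence.to adj⇔ a)))
                                       λ { (inj₁ ()) ; (inj₂ (_ , e)) → Equivalence.from adj⇔ (suc-injective (suc-injective e)) }
    where
    adj⇔ : Adj v (lookup L j) ⇔ (suc (toℕ j) ≡ length L)
    adj⇔ = proj₂ (closes-lookup v L closes j)
  adjIff (suc i) (suc j) (s≤s i<j) = mk⇔ (inj₁ ∘ cong suc ∘ Equivalence.to snake⇔)
                                          λ { (inj₁ e) → Equivalence.from snake⇔ (suc-injective e) ; (inj₂ (() , _)) }
    where
    snake⇔ : Adj (lookup (s ∷ L) i) (lookup (s ∷ L) j) ⇔ (suc (toℕ i) ≡ toℕ j)
    snake⇔ = snake-adjIff (s ∷ L) snake i j i<j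

2≤∣-∣ : ∀ a b → 2 + a ≤ b → 2 ≤ ∣ a - b ∣
2≤∣-∣ zero    b       2≤b       = 2≤b
2≤∣-∣ (suc a) (suc b) (s≤s 2+a≤b) = 2≤∣-∣ a b 2+a≤b

apartˣ : ∀ {x y a b} → 2 ≤ ∣ x - a ∣ → Apart (x , y) (a , b)
apartˣ {x} 2≤dx = (λ { refl → contradiction (subst (2 ≤_) (m≡n⇒∣m-n∣≡0 {x} refl) 2≤dx) λ () })
                , (λ (dx , _) → contradiction (subst (2 ≤_) dx 2≤dx) λ { (s≤s ()) })

apartʸ : ∀ {x y a b} → 2 ≤ ∣ y - b ∣ → Apart (x , y) (a , b)
apartʸ {y = y} 2≤dy = (λ { refl → contradiction (subst (2 ≤_) (m≡n⇒∣m-n∣≡0 {y} refl) 2≤dy) λ () })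
                    , (λ (_ , dy) → contradiction (subst (2 ≤_) dy 2≤dy) λ { (s≤s ()) })

apart-x< : ∀ c d → 2 + proj₁ c ≤ proj₁ d → Apart c d
apart-x< (x , _) (a , _) h = apartˣ (2≤∣-∣ x a h)

apart-x> : ∀ c d → 2 + proj₁ d ≤ proj₁ c → Apart c d
apart-x> (x , _) (a , _) h = apartˣ (subst (2 ≤_) (∣-∣-comm a x) (2≤∣-∣ a x h))

apart-y< : ∀ c d → 2 + proj₂ c ≤ proj₂ d → Apart c d
apart-y< (_ , y) (_ , b) h = apartʸ (2≤∣-∣ y b h)

apart-y> : ∀ c d → 2 + proj₂ d ≤ proj₂ c → Apart c d
apart-y> (_ , y) (_ , b) h = apartʸ (subst (2 ≤_) (∣-∣-comm b y) (2≤∣-∣ b y h))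

adj⁺⁺ : ∀ a b → Adj (a , b) (suc a , suc b)
adj⁺⁺ a b = ∣n-1+n∣≡1 a , ∣n-1+n∣≡1 b

adj⁺⁻ : ∀ a b → Adj (a , suc b) (suc a , b)
adj⁺⁻ a b = ∣n-1+n∣≡1 a , ∣1+n-n∣≡1 b

adj⁻⁺ : ∀ a b → Adj (suc a , b) (a , suc b)
adj⁻⁺ a b = ∣1+n-n∣≡1 a , ∣n-1+n∣≡1 b

adj⁻⁻ : ∀ a b → Adj (suc a , suc b) (a , b)
adj⁻⁻ a b = ∣1+n-n∣≡1 a , ∣1+n-n∣≡1 b

BoxApart : ℕ → ℕ → ℕ → ℕ → Cell → Set
BoxApart x₀ x₁ y₀ y₁ t = ∀ u v → x₀ ≤ u → u ≤ x₁ → y₀ ≤ v → v ≤ y₁ → Apart (u , v) t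

boxApart-x+ : ∀ {x₀ x₁ y₀ y₁} t → 2 + x₁ ≤ proj₁ t → BoxApart x₀ x₁ y₀ y₁ t
boxApart-x+ t h u v _ u≤x₁ _ _ = apart-x< (u , v) t (≤-trans (+-monoʳ-≤ 2 u≤x₁) h)

boxApart-x- : ∀ {x₀ x₁ y₀ y₁} t → 2 + proj₁ t ≤ x₀ → BoxApart x₀ x₁ y₀ y₁ t
boxApart-x- t h u v x₀≤u _ _ _ = apart-x> (u , v) t (≤-trans h x₀≤u)

boxApart-y+ : ∀ {x₀ x₁ y₀ y₁} t → 2 + y₁ ≤ proj₂ t → BoxApart x₀ x₁ y₀ y₁ t
boxApart-y+ t h u v _ _ _ v≤y₁ = apart-y< (u , v) t (≤-trans (+-monoʳ-≤ 2 v≤y₁) h)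

boxApart-y- : ∀ {x₀ x₁ y₀ y₁} t → 2 + proj₂ t ≤ y₀ → BoxApart x₀ x₁ y₀ y₁ t
boxApart-y- t h u v _ _ y₀≤v _ = apart-y> (u , v) t (≤-trans h y₀≤v)

boxApart-shrink : ∀ {x₀ x₁ y₀ y₁ x₀′ x₁′ y₀′ y₁′} → x₀ ≤ x₀′ → x₁′ ≤ x₁ → y₀ ≤ y₀′ → y₁′ ≤ y₁ →
                  ∀ {t} → BoxApart x₀ x₁ y₀ y₁ t → BoxApart x₀′ x₁′ y₀′ y₁′ t
boxApart-shrink a b c d apart u v h₁ h₂ h₃ h₄ = apart u v (≤-trans a h₁) (≤-trans h₂ b) (≤-trans c h₃) (≤-trans h₄ d)

boxApart-at : ∀ {x₀ x₁ y₀ y₁} u v → x₀ ≤ u → u ≤ x₁ → y₀ ≤ v → v ≤ y₁ →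
              ∀ {T} → All (BoxApart x₀ x₁ y₀ y₁) T → All (Apart (u , v)) T
boxApart-at u v h₁ h₂ h₃ h₄ = All.map λ apart → apart u v h₁ h₂ h₃ h₄

-- Instantiated with All P and with Closes v, so that each prepend- lemma below serves both.
ConsClosed : (List Cell → Set) → (Cell → Set) → Set
ConsClosed Φ P = ∀ c T → P c → Φ T → Φ (c ∷ T)

All-consClosed : ∀ {P} → ConsClosed (All P) P
All-consClosed _ _ = _∷_

Closes-consClosed : ∀ v → ConsClosed (Closes v) (Apart v)
Closes-consClosed v c (_ ∷ _) apart closes = apart , closes

-- The construction

double : ℕ → ℕ
double zero    = zero
double (suc k) = suc (suc (double k))

_+2×_ : ℕ → ℕ → ℕ
x +2× zero  = x
x +2× suc k = suc (suc x) +2× k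

x≤x+2×k : ∀ x k → x ≤ x +2× k
x≤x+2×k x zero    = ≤-refl
x≤x+2×k x (suc k) = ≤-trans (m≤n+m x 2) (x≤x+2×k (suc (suc x)) k)

x+2×k≡double : ∀ x k → x +2× k ≡ double k + x
x+2×k≡double x zero    = refl
x+2×k≡double x (suc k) = trans (x+2×k≡double (suc (suc x)) k) (trans (+-suc (double k) (suc x)) (cong suc (+-suc (double k) x)))

zigzagRight : ℕ → ℕ → ℕ → List Cell → List Cell
zigzagRight x y zero    T = T
zigzagRight x y (suc k) T = (x , y) ∷ (suc x , suc y) ∷ zigzagRight (suc (suc x)) y k T

zigzagLeft : ℕ → ℕ → ℕ → List Cell → List Cell
zigzagLeft x y zero    T = T
zigzagLeft x y (suc k) T = (suc (double k + x) , y) ∷ (double k + x , suc y) ∷ zigzagLeft x y k T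

zigzagDown : ℕ → ℕ → List Cell → List Cell
zigzagDown b zero    T = T
zigzagDown b (suc k) T = (1 , suc (double k + b)) ∷ (0 , double k + b) ∷ zigzagDown b k T

OnRows : ℕ → ℕ → Set
OnRows y v = v ≡ y ⊎ v ≡ suc y

prepend-zigzagRight : ∀ {Φ P} → ConsClosed Φ P → ∀ k x y {T} →
                      (∀ u v → x ≤ u → u < x +2× k → OnRows y v → P (u , v)) → Φ T → Φ (zigzagRight x y k T)
prepend-zigzagRight cons zero    x y box φ = φ
prepend-zigzagRight cons (suc k) x y box φ =
  cons _ _ (box x y ≤-refl (≤-trans (s≤s (n≤1+n x)) (x≤x+2×k (suc (suc x)) k)) (inj₁ refl))
    (cons _ _ (box (suc x) (suc y) (n≤1+n x) (x≤x+2×k (suc (suc x)) k) (inj₂ refl))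
      (prepend-zigzagRight cons k (suc (suc x)) y (λ u v 2+x≤u → box u v (≤-trans (m≤n+m x 2) 2+x≤u)) φ))

prepend-zigzagLeft : ∀ {Φ P} → ConsClosed Φ P → ∀ k x y {T} →
                     (∀ u v → x ≤ u → u < double k + x → OnRows y v → P (u , v)) → Φ T → Φ (zigzagLeft x y k T)
prepend-zigzagLeft cons zero    x y box φ = φ
prepend-zigzagLeft cons (suc k) x y box φ =
  cons _ _ (box (suc (double k + x)) y (≤-trans (m≤n+m x (double k)) (n≤1+n _)) ≤-refl (inj₁ refl))
    (cons _ _ (box (double k + x) (suc y) (m≤n+m x (double k)) (n≤1+n _) (inj₂ refl))
      (prepend-zigzagLeft cons k x y (λ u v x≤u u< → box u v x≤u (≤-trans u< (m≤n+m _ 2))) φ))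

prepend-zigzagDown : ∀ {Φ P} → ConsClosed Φ P → ∀ k b {T} →
                     (∀ u v → u ≤ 1 → b ≤ v → v < double k + b → P (u , v)) → Φ T → Φ (zigzagDown b k T)
prepend-zigzagDown cons zero    b box φ = φ
prepend-zigzagDown cons (suc k) b box φ =
  cons _ _ (box 1 (suc (double k + b)) ≤-refl (≤-trans (m≤n+m b (double k)) (n≤1+n _)) ≤-refl)
    (cons _ _ (box 0 (double k + b) z≤n (m≤n+m b (double k)) (n≤1+n _))
      (prepend-zigzagDown cons k b (λ u v u≤1 b≤v v< → box u v u≤1 b≤v (≤-trans v< (m≤n+m _ 2))) φ))

zigzagRight-snake : ∀ k x y {T} → Snake T → Prependable (suc (x +2× k) , suc y) T →
                    All (BoxApart x (x +2× k) y (suc y)) T → Snake (zigzagRight x y (suc k) T)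
zigzagRight-snake zero    x y snake prep far =
  (snake , prep) , adj⁺⁺ x y , boxApart-at x y ≤-refl ≤-refl ≤-refl (n≤1+n y) far
zigzagRight-snake (suc k) x y {T} snake prep far =
  (rest , adj⁺⁻ (suc x) y ,
     apart-x< _ _ ≤-refl ∷ prepend-zigzagRight All-consClosed k (4 + x) y (λ u v 4+x≤u _ _ → apart-x< _ _ (≤-trans (n≤1+n _) 4+x≤u))
       (boxApart-at (suc x) (suc y) (n≤1+n x) (≤-trans (m≤n+m (suc x) 1) (x≤x+2×k (2 + x) k)) (n≤1+n y) ≤-refl far))
  , adj⁺⁺ x y ,
     prepend-zigzagRight All-consClosed (suc k) (2 + x) y (λ u v 2+x≤u _ _ → apart-x< _ _ 2+x≤u)
       (boxApart-at x y ≤-refl (x≤x+2×k x (suc k)) ≤-refl (n≤1+n y) far)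
  where
  rest : Snake (zigzagRight (2 + x) y (suc k) T)
  rest = zigzagRight-snake k (2 + x) y snake prep (All.map (boxApart-shrink (m≤n+m x 2) ≤-refl ≤-refl ≤-refl) far)

zigzagLeft-snake : ∀ k x y {T} → Snake T → Prependable (x , suc y) T →
                   All (BoxApart (suc x) (suc (double k + x)) y (suc y)) T → Snake (zigzagLeft x y (suc k) T)
zigzagLeft-snake zero    x y snake prep far =
  (snake , prep) , adj⁻⁺ x y , boxApart-at (suc x) y ≤-refl ≤-refl ≤-refl (n≤1+n y) far
zigzagLeft-snake (suc k) x y {T} snake prep far =
  (rest , adj⁻⁻ (suc (double k + x)) y ,
     apart-x> _ _ ≤-refl ∷ prepend-zigzagLeft All-consClosed k x y (λ u v _ u< _ → apart-x> _ _ (s≤s (≤-trans u< (n≤1+n _))))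
       (boxApart-at (2 + (double k + x)) (suc y) (s≤s (≤-trans (m≤n+m x (double k)) (n≤1+n _))) (n≤1+n _) (n≤1+n y) ≤-refl far))
  , adj⁻⁺ (2 + (double k + x)) y ,
     prepend-zigzagLeft All-consClosed (suc k) x y (λ u v _ u< _ → apart-x> _ _ (s≤s u<))
       (boxApart-at (3 + (double k + x)) y (s≤s (≤-trans (m≤n+m x (double k)) (m≤n+m _ 2))) ≤-refl ≤-refl (n≤1+n y) far)
  where
  rest : Snake (zigzagLeft x y (suc k) T)
  rest = zigzagLeft-snake k x y snake prep (All.map (boxApart-shrink ≤-refl (s≤s (m≤n+m _ 2)) ≤-refl ≤-refl) far)

zigzagDown-snake : ∀ k b {T} → Snake T → Prependable (0 , b) T →
                   All (BoxApart 0 1 (suc b) (suc (double k + b))) T → Snake (zigzagDown b (suc k) T)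
zigzagDown-snake zero    b snake prep far =
  (snake , prep) , adj⁻⁻ 0 b , boxApart-at 1 (suc b) z≤n ≤-refl ≤-refl ≤-refl far
zigzagDown-snake (suc k) b {T} snake prep far =
  (rest , adj⁺⁻ 0 (suc (double k + b)) ,
     apart-y> _ _ ≤-refl ∷ prepend-zigzagDown All-consClosed k b (λ u v _ _ v< → apart-y> _ _ (s≤s (≤-trans v< (n≤1+n _))))
       (boxApart-at 0 (2 + (double k + b)) z≤n z≤n (s≤s (≤-trans (m≤n+m b (double k)) (n≤1+n _))) (n≤1+n _) far))
  , adj⁻⁻ 0 (2 + (double k + b)) ,
     prepend-zigzagDown All-consClosed (suc k) b (λ u v _ _ v< → apart-y> _ _ (s≤s v<))
       (boxApart-at 1 (3 + (double k + b)) z≤n ≤-refl (s≤s (≤-trans (m≤n+m b (double k)) (m≤n+m _ 2))) ≤-refl far)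
  where
  rest : Snake (zigzagDown b (suc k) T)
  rest = zigzagDown-snake k b snake prep (All.map (boxApart-shrink ≤-refl ≤-refl ≤-refl (s≤s (m≤n+m _ 2))) far)

onRows-≥ : ∀ {y v} → OnRows y v → y ≤ v
onRows-≥ (inj₁ refl) = ≤-refl
onRows-≥ (inj₂ refl) = n≤1+n _

onRows-≤ : ∀ {y v} → OnRows y v → v ≤ suc y
onRows-≤ (inj₁ refl) = n≤1+n _
onRows-≤ (inj₂ refl) = ≤-refl

double≡2* : ∀ k → double k ≡ 2 * k
double≡2* zero    = refl
double≡2* (suc k) = trans (cong (2 +_) (double≡2* k)) (sym (*-suc 2 k))

length-zigzagRight : ∀ k x y T → length (zigzagRight x y k T) ≡ double k + length T
length-zigzagRight zero    x y T = refl
length-zigzagRight (suc k) x y T = cong (2 +_) (length-zigzagRight k (2 + x) y T)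

length-zigzagLeft : ∀ k x y T → length (zigzagLeft x y k T) ≡ double k + length T
length-zigzagLeft zero    x y T = refl
length-zigzagLeft (suc k) x y T = cong (2 +_) (length-zigzagLeft k x y T)

OnLadder : Cell → Set
OnLadder t = proj₁ t ≤ 1 ⊎ t ≡ (2 , 0)

onLadder-apart : ∀ Y {t} → OnLadder t → Apart (3 , 5 + Y) t
onLadder-apart Y (inj₁ x≤1) = apart-x> _ _ (s≤s (s≤s x≤1))
onLadder-apart Y (inj₂ refl) = apart-y> _ _ (s≤s (s≤s z≤n))

onLadder-boxApart : ∀ {x₁ y₀ y₁ t} → OnLadder t → BoxApart 4 x₁ y₀ y₁ t
onLadder-boxApart {t = t} (inj₁ x≤1) = boxApart-x- t (≤-trans (s≤s (s≤s x≤1)) (n≤1+n 3))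
onLadder-boxApart (inj₂ refl) = boxApart-x- _ ≤-refl

-- A block on rows Y, …, Y + 5: a zigzag from column 4 to the right on rows Y and Y + 1, the cell
-- (D + 2, Y + 2), a zigzag back to column 4 on rows Y + 3 and Y + 4, and the cell (3, Y + 5), which
-- leads to the first cell (4, Y + 6) of the next block.
module Blocks (W : ℕ) where

  D : ℕ
  D = double W + 4

  4≤2+D : 4 ≤ 2 + D
  4≤2+D = ≤-trans (m≤n+m 4 (double W)) (m≤n+m _ 2)

  block : ℕ → List Cell → List Cell
  block Y T = zigzagRight 4 Y (suc W) ((2 + D , 2 + Y) ∷ zigzagLeft 4 (3 + Y) (suc W) ((3 , 5 + Y) ∷ T))

  blocks : ℕ → ℕ → List Cell → List Cell
  blocks Y zero    T = T
  blocks Y (suc j) T = block Y (blocks (6 + Y) j T)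

  prepend-block : ∀ {Φ P} → ConsClosed Φ P → ∀ Y {T} →
                  (∀ u v → 3 ≤ u → u ≤ 2 + D → Y ≤ v → v ≤ 5 + Y → P (u , v)) → Φ T → Φ (block Y T)
  prepend-block cons Y box φ =
    prepend-zigzagRight cons (suc W) 4 Y
      (λ u v 4≤u u< rows → box u v (4≤⇒3≤ 4≤u) (≤-trans (<⇒≤ u<) (≤-reflexive right-end))
                                (onRows-≥ rows) (≤-trans (onRows-≤ rows) (+-monoˡ-≤ Y (m≤m+n 1 4))))
      (cons _ _ (box (2 + D) (2 + Y) (4≤⇒3≤ 4≤2+D) ≤-refl (m≤n+m Y 2) (+-monoˡ-≤ Y (m≤m+n 2 3)))
        (prepend-zigzagLeft cons (suc W) 4 (3 + Y)
          (λ u v 4≤u u< rows → box u v (4≤⇒3≤ 4≤u) (<⇒≤ u<)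
                                    (≤-trans (m≤n+m Y 3) (onRows-≥ rows)) (≤-trans (onRows-≤ rows) (n≤1+n _)))
          (cons _ _ (box 3 (5 + Y) ≤-refl (4≤⇒3≤ 4≤2+D) (m≤n+m Y 5) ≤-refl) φ)))
    where
    4≤⇒3≤ : ∀ {u} → 4 ≤ u → 3 ≤ u
    4≤⇒3≤ = ≤-trans (n≤1+n 3)
    right-end : 4 +2× suc W ≡ 2 + D
    right-end = trans (x+2×k≡double 6 W) (trans (+-suc (double W) 5) (cong suc (+-suc (double W) 4)))

  prepend-blocks : ∀ {Φ P} → ConsClosed Φ P → ∀ j Y {T} →
                   (∀ u v → 3 ≤ u → u ≤ 2 + D → Y ≤ v → v < j * 6 + Y → P (u , v)) → Φ T → Φ (blocks Y j T)
  prepend-blocks cons zero    Y box φ = φ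
  prepend-blocks cons (suc j) Y box φ =
    prepend-block cons Y (λ u v 3≤u u≤ Y≤v v≤5+Y → box u v 3≤u u≤ Y≤v (≤-trans (s≤s v≤5+Y) (+-monoˡ-≤ Y (m≤m+n 6 (j * 6)))))
      (prepend-blocks cons j (6 + Y)
        (λ u v 3≤u u≤ 6+Y≤v v< → box u v 3≤u u≤ (≤-trans (m≤n+m Y 6) 6+Y≤v) (≤-trans v< (≤-reflexive (reassoc j Y)))) φ)
    where
    reassoc : ∀ j Y → j * 6 + (6 + Y) ≡ suc j * 6 + Y
    reassoc = solve-∀

  block-snake : ∀ Y h T → Snake (h ∷ T) → Adj (3 , 5 + Y) h → All (Apart (3 , 5 + Y)) T →
                All (BoxApart 4 (2 + D) Y (4 + Y)) (h ∷ T) → Snake (block Y (h ∷ T))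
  block-snake Y h T snake adj apart far =
    zigzagRight-snake W 4 Y (snakeLeft , prependCorner)
      (subst (λ x → Prependable (suc x , suc Y) (corner ∷ left)) (sym 4+2×W≡D) prependRight)
      (subst (λ x → All (BoxApart 4 x Y (suc Y)) (corner ∷ left)) (sym 4+2×W≡D) farRight)
    where
    corner : Cell
    corner = (2 + D , 2 + Y)
    left : List Cell
    left = zigzagLeft 4 (3 + Y) (suc W) ((3 , 5 + Y) ∷ h ∷ T)
    4+2×W≡D : 4 +2× W ≡ D
    4+2×W≡D = x+2×k≡double 4 W
    snakeLeft : Snake left
    snakeLeft = zigzagLeft-snake W 4 (3 + Y) (snake , adj , apart)
      (adj⁻⁺ 3 (4 + Y) , boxApart-at 4 (4 + Y) ≤-refl 4≤2+D (m≤n+m Y 4) ≤-refl far)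
      (boxApart-x- (3 , 5 + Y) ≤-refl ∷ All.map (boxApart-shrink (n≤1+n 4) (n≤1+n _) (m≤n+m Y 3) ≤-refl) far)
    prependCorner : Prependable corner left
    prependCorner = adj⁻⁺ (suc D) (2 + Y) ,
      apart-y< _ _ ≤-refl ∷ prepend-zigzagLeft All-consClosed W 4 (3 + Y) (λ u v _ u<D _ → apart-x> _ _ (s≤s (s≤s (<⇒≤ u<D))))
        (apart-y< _ _ (n≤1+n _) ∷ boxApart-at (2 + D) (2 + Y) 4≤2+D ≤-refl (m≤n+m Y 2) (+-monoˡ-≤ Y (m≤m+n 2 2)) far)
    prependRight : Prependable (suc D , suc Y) (corner ∷ left)
    prependRight = adj⁺⁺ (suc D) (suc Y) ,
      prepend-zigzagLeft All-consClosed (suc W) 4 (3 + Y) (λ u v _ _ rows → apart-y< _ _ (onRows-≥ rows))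
        (apart-y< _ _ (+-monoˡ-≤ Y (m≤m+n 3 2))
         ∷ boxApart-at (suc D) (suc Y) (≤-trans (m≤n+m 4 (double W)) (n≤1+n D)) (n≤1+n _) (n≤1+n Y)
                       (+-monoˡ-≤ Y (m≤m+n 1 3)) far)
    farRight : All (BoxApart 4 D Y (suc Y)) (corner ∷ left)
    farRight = boxApart-x+ corner ≤-refl ∷
      prepend-zigzagLeft All-consClosed (suc W) 4 (3 + Y) (λ u v _ _ rows → boxApart-y+ (u , v) (onRows-≥ rows))
        (boxApart-y+ (3 , 5 + Y) (+-monoˡ-≤ Y (m≤m+n 3 2))
         ∷ All.map (boxApart-shrink ≤-refl (m≤n+m D 2) ≤-refl (+-monoˡ-≤ Y (m≤m+n 1 3))) far)

  blocks-snake : ∀ j Y Ye {T} → Ye ≡ suc j * 6 + Y → Snake ((2 , Ye) ∷ T) → All OnLadder T →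
                 Snake (blocks Y (suc j) ((2 , Ye) ∷ T))
  blocks-snake zero Y _ refl snake ladder =
    block-snake Y (2 , 6 + Y) _ snake (adj⁻⁺ 2 (5 + Y)) (All.map (onLadder-apart Y) ladder)
      (boxApart-x- _ ≤-refl ∷ All.map onLadder-boxApart ladder)
  blocks-snake (suc j) Y Ye {T} Ye≡ snake ladder =
    block-snake Y _ _ (blocks-snake j (6 + Y) Ye (trans Ye≡ (reassoc j Y)) snake ladder) (adj⁺⁺ 3 (5 + Y)) apart far
    where
    reassoc : ∀ j Y → suc (suc j) * 6 + Y ≡ suc j * 6 + (6 + Y)
    reassoc = solve-∀
    apart : All (Apart (3 , 5 + Y)) (drop 1 (blocks (6 + Y) (suc j) ((2 , Ye) ∷ T)))
    apart = apart-y< _ _ ≤-refl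
      ∷ prepend-zigzagRight All-consClosed W 6 (6 + Y) (λ u v 6≤u _ _ → apart-x< _ _ (≤-trans (n≤1+n 5) 6≤u))
          (apart-y< _ _ (+-monoˡ-≤ Y (m≤m+n 7 1))
           ∷ prepend-zigzagLeft All-consClosed (suc W) 4 (9 + Y) (λ u v _ _ rows → apart-y< _ _ (≤-trans (+-monoˡ-≤ Y (m≤m+n 7 2)) (onRows-≥ rows)))
               (apart-y< _ _ (+-monoˡ-≤ Y (m≤m+n 7 4))
                ∷ prepend-blocks All-consClosed j (12 + Y) (λ u v _ _ 12+Y≤v _ → apart-y< _ _ (≤-trans (+-monoˡ-≤ Y (m≤m+n 7 5)) 12+Y≤v))
                    (apart-y< _ _ (≤-trans (+-monoˡ-≤ Y (m≤m+n 7 (5 + j * 6))) (≤-reflexive (sym (trans Ye≡ (reassoc′ j Y)))))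
                     ∷ All.map (onLadder-apart Y) ladder)))
      where
      reassoc′ : ∀ j Y → suc (suc j) * 6 + Y ≡ 7 + (5 + j * 6) + Y
      reassoc′ = solve-∀
    far : All (BoxApart 4 (2 + D) Y (4 + Y)) (blocks (6 + Y) (suc j) ((2 , Ye) ∷ T))
    far = prepend-blocks All-consClosed (suc j) (6 + Y) (λ u v _ _ 6+Y≤v _ → boxApart-y+ (u , v) 6+Y≤v)
            (boxApart-x- _ ≤-refl ∷ All.map onLadder-boxApart ladder)

  length-block : ∀ Y T → 4 * suc W + length T ≤ length (block Y T)
  length-block Y T = ≤-trans (m≤n+m _ 2) (≤-reflexive (begin
    2 + (4 * suc W + length T)                             ≡⟨ regroup (suc W) (length T) ⟩
    2 * suc W + suc (2 * suc W + suc (length T))           ≡⟨ cong (λ d → d + suc (d + suc (length T))) (sym (double≡2* (suc W))) ⟩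
    double (suc W) + suc (double (suc W) + suc (length T)) ≡⟨ cong (λ l → double (suc W) + suc l)
                                                                 (sym (length-zigzagLeft (suc W) 4 (3 + Y) ((3 , 5 + Y) ∷ T))) ⟩
    double (suc W) + length ((2 + D , 2 + Y) ∷ zigzagLeft 4 (3 + Y) (suc W) ((3 , 5 + Y) ∷ T))
                                                           ≡⟨ sym (length-zigzagRight (suc W) 4 Y _) ⟩
    length (block Y T)                                     ∎))
    where
    open ≡-Reasoning
    regroup : ∀ w l → 2 + (4 * w + l) ≡ 2 * w + suc (2 * w + suc l)
    regroup = solve-∀

  length-blocks : ∀ j Y T → j * (4 * suc W) + length T ≤ length (blocks Y j T)
  length-blocks zero    Y T = ≤-refl
  length-blocks (suc j) Y T = begin
    suc j * (4 * suc W) + length T                ≡⟨ +-assoc (4 * suc W) (j * (4 * suc W)) (length T) ⟩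
    4 * suc W + (j * (4 * suc W) + length T)      ≤⟨ +-monoʳ-≤ (4 * suc W) (length-blocks j (6 + Y) T) ⟩
    4 * suc W + length (blocks (6 + Y) j T)       ≤⟨ length-block Y (blocks (6 + Y) j T) ⟩
    length (blocks Y (suc j) T)                   ∎
    where open ≤-Reasoning

-- The cycle starts at (3, 1), runs through J + 1 blocks and the cell (2, top) in the row after them, and
-- returns along a ladder in columns 0 and 1 down to (1, 1) and (2, 0).
module Construction (W J : ℕ) where
  open Blocks W

  K : ℕ
  K = 3 * J + 1

  top : ℕ
  top = 2 + (double K + 2)

  top≡ : top ≡ suc J * 6 + 0
  top≡ = trans (cong (λ d → 2 + (d + 2)) (double≡2* K)) (arith J)
    where
    arith : ∀ J → 2 + (2 * (3 * J + 1) + 2) ≡ suc J * 6 + 0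
    arith = solve-∀

  3≤top : 3 ≤ top
  3≤top = s≤s (s≤s (≤-trans (s≤s z≤n) (m≤n+m 2 (double K))))

  foot : List Cell
  foot = (1 , 1) ∷ (2 , 0) ∷ []

  ladder : List Cell
  ladder = zigzagDown 2 (suc K) foot

  route : List Cell
  route = blocks 0 (suc J) ((2 , top) ∷ ladder)

  ladder-snake : Snake ((2 , top) ∷ ladder)
  ladder-snake =
    zigzagDown-snake K 2 (((_ , _) , adj⁻⁺ 1 0 , []))
                     (adj⁻⁻ 0 1 , apart-x< _ _ ≤-refl ∷ [])
                     (boxApart-y- _ ≤-refl ∷ boxApart-y- _ (s≤s (s≤s z≤n)) ∷ [])
    , adj⁻⁻ 1 (suc (double K + 2)) ,
      apart-x> _ _ ≤-refl
      ∷ prepend-zigzagDown All-consClosed K 2 (λ u v _ _ v< → apart-y> _ _ (s≤s (s≤s (<⇒≤ v<))))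
          (apart-y> _ _ 3≤top ∷ apart-y> _ _ (s≤s (s≤s z≤n)) ∷ [])

  ladder-onLadder : All OnLadder ladder
  ladder-onLadder = prepend-zigzagDown All-consClosed (suc K) 2 (λ u v u≤1 _ _ → inj₁ u≤1) (inj₁ ≤-refl ∷ inj₂ refl ∷ [])

  route-snake : Snake route
  route-snake = blocks-snake J 0 top top≡ ladder-snake ladder-onLadder

  closes : Closes (3 , 1) (drop 1 route)
  closes =
    close (5 , 1) (apart-x< _ _ ≤-refl)
      (prepend-zigzagRight (Closes-consClosed (3 , 1)) W 6 0 (λ u v 6≤u _ _ → apart-x< _ _ (≤-trans (n≤1+n 5) 6≤u))
        (close (2 + D , 2) {zigzagLeft 4 3 (suc W) ((3 , 5) ∷ blocks 6 J ((2 , top) ∷ ladder))}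
               (apart-x< _ _ (≤-trans (n≤1+n 5) (s≤s (s≤s (m≤n+m 4 (double W))))))
          (prepend-zigzagLeft (Closes-consClosed (3 , 1)) (suc W) 4 3 (λ u v _ _ rows → apart-y< _ _ (onRows-≥ rows))
            (close (3 , 5) (apart-y< _ _ (s≤s (s≤s (s≤s z≤n))))
              (prepend-blocks (Closes-consClosed (3 , 1)) J 6 {(2 , top) ∷ ladder}
                              (λ u v _ _ 6≤v _ → apart-y< _ _ (≤-trans (m≤m+n 3 3) 6≤v))
                (close (2 , top) {ladder} (apart-y< _ _ 3≤top)
                  (prepend-zigzagDown (Closes-consClosed (3 , 1)) (suc K) 2 {foot} (λ u v u≤1 _ _ → apart-x> _ _ (s≤s (s≤s u≤1)))
                    (apart-x> _ _ ≤-refl , adj⁻⁻ 2 0))))))))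
    where
    close : ∀ c {T} → Apart (3 , 1) c → Closes (3 , 1) T → Closes (3 , 1) (c ∷ T)
    close c {T} = Closes-consClosed (3 , 1) c T

  cycle : ∀ {m n} → 2 + D < n → top < m → Σ[ Q ∈ SnakeCycle m n ] suc J * (4 * suc W) ≤ SnakeCycle.len Q
  cycle {m} {n} 2+D<n top<m = proj₁ built , (begin
    suc J * (4 * suc W)                                      ≤⟨ m≤m+n _ (length ((2 , top) ∷ ladder)) ⟩
    suc J * (4 * suc W) + length ((2 , top) ∷ ladder)        ≤⟨ length-blocks (suc J) 0 ((2 , top) ∷ ladder) ⟩
    length route                                             ≤⟨ n≤1+n _ ⟩
    2 + length (drop 1 route)                                ≡⟨ sym (proj₂ built) ⟩
    SnakeCycle.len (proj₁ built)                             ∎)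
    where
    open ≤-Reasoning
    cell : ∀ {u v} → u ≤ 2 + D → v ≤ top → InGrid m n (u , v)
    cell u≤2+D v≤top = ≤-<-trans u≤2+D 2+D<n , ≤-<-trans v≤top top<m
    near : ∀ {u} → u ≤ 4 → u ≤ 2 + D
    near u≤4 = ≤-trans u≤4 4≤2+D
    inGrid : All (InGrid m n) ((3 , 1) ∷ route)
    inGrid = cell (near (n≤1+n 3)) (≤-trans (s≤s z≤n) 3≤top)
      ∷ prepend-blocks All-consClosed (suc J) 0 (λ u v _ u≤2+D _ v< → cell u≤2+D (≤-trans (<⇒≤ v<) (≤-reflexive (sym top≡))))
          (cell (near (m≤m+n 2 2)) ≤-refl
           ∷ prepend-zigzagDown All-consClosed (suc K) 2 (λ u v u≤1 _ v< → cell (near (≤-trans u≤1 (s≤s z≤n))) (<⇒≤ v<))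
               (cell (near (s≤s z≤n)) (≤-trans (s≤s z≤n) 3≤top) ∷ cell (near (m≤m+n 2 2)) z≤n ∷ []))
    built : Σ[ Q ∈ SnakeCycle m n ] SnakeCycle.len Q ≡ 2 + length (drop 1 route)
    built = snakeCycle (3 , 1) (4 , 0) (drop 1 route) route-snake (adj⁺⁻ 3 0) closes inGrid

divide-above : ∀ k d {m} → k ≤ m → Σ[ q ∈ ℕ ] k + q * suc d ≤ m × m ≤ k + (d + q * suc d)
divide-above k d {m} k≤m =
  q , ≤-trans (+-monoʳ-≤ k (subst (q * suc d ≤_) (sym rest≡) (m≤n+m _ (rest % suc d)))) (≤-reflexive k+rest≡m)
    , ≤-trans (≤-reflexive (sym k+rest≡m)) (+-monoʳ-≤ k (subst (_≤ d + q * suc d) (sym rest≡) (+-monoˡ-≤ _ (≤-pred (m%n<n rest (suc d))))))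
  where
  rest : ℕ
  rest = m ∸ k
  q : ℕ
  q = rest / suc d
  rest≡ : rest ≡ rest % suc d + q * suc d
  rest≡ = m≡m%n+[m/n]*n rest (suc d)
  k+rest≡m : k + rest ≡ m
  k+rest≡m = m+[n∸m]≡n k≤m

construction-arith : ∀ {m n J W L} → 7 + J * 6 ≤ m → m ≤ 12 + J * 6 → 7 + W * 2 ≤ n → n ≤ 8 + W * 2 →
                     suc J * (4 * suc W) ≤ L → m * n ≤ 3 * L + 9 * (m + n)
construction-arith {m} {n} {J} {W} {L} m≥ m≤ n≥ n≤ L≥ = begin
  m * n                                          ≤⟨ *-mono-≤ m≤ n≤ ⟩
  (12 + J * 6) * (8 + W * 2)                     ≡⟨ expand J W ⟩
  3 * (suc J * (4 * suc W)) + (84 + J * 36 + W * 12) ≤⟨ +-mono-≤ (*-monoʳ-≤ 3 L≥) (m≤m+n _ (42 + J * 18 + W * 6)) ⟩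
  3 * L + ((84 + J * 36 + W * 12) + (42 + J * 18 + W * 6)) ≡⟨ cong (3 * L +_) (collect J W) ⟩
  3 * L + 9 * ((7 + J * 6) + (7 + W * 2))        ≤⟨ +-monoʳ-≤ (3 * L) (*-monoʳ-≤ 9 (+-mono-≤ m≥ n≥)) ⟩
  3 * L + 9 * (m + n)                            ∎
  where
  open ≤-Reasoning
  expand : ∀ J W → (12 + J * 6) * (8 + W * 2) ≡ 3 * (suc J * (4 * suc W)) + (84 + J * 36 + W * 12)
  expand = solve-∀
  collect : ∀ J W → (84 + J * 36 + W * 12) + (42 + J * 18 + W * 6) ≡ 9 * ((7 + J * 6) + (7 + W * 2))
  collect = solve-∀

large-cycle-lowerBound : ∀ {m n} → 7 ≤ m → 7 ≤ n → Σ[ Q ∈ SnakeCycle m n ] m * n ≤ 3 * SnakeCycle.len Q + 9 * (m + n)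
large-cycle-lowerBound {m} {n} 7≤m 7≤n with divide-above 7 5 7≤m | divide-above 7 1 7≤n
... | J , m≥ , m≤ | W , n≥ , n≤ = proj₁ cycle , construction-arith {J = J} {W = W} m≥ m≤ n≥ n≤ (proj₂ cycle)
  where
  open Blocks W using (D)
  open Construction W J using (top; top≡)
  2+D<n : 2 + D < n
  2+D<n = ≤-trans (≤-reflexive (trans (cong (λ d → 3 + (d + 4)) (double≡2* W)) (arith W))) n≥
    where
    arith : ∀ W → 3 + (2 * W + 4) ≡ 7 + W * 2
    arith = solve-∀
  top<m : top < m
  top<m = ≤-trans (≤-reflexive (trans (cong suc top≡) (arith J))) m≥
    where
    arith : ∀ J → suc (suc J * 6 + 0) ≡ 7 + J * 6
    arith = solve-∀
  cycle : Σ[ Q ∈ SnakeCycle m n ] suc J * (4 * suc W) ≤ SnakeCycle.len Q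
  cycle = Construction.cycle W J 2+D<n top<m

singleCell : ∀ {m n} → 1 ≤ m → 1 ≤ n → SnakePath m n
singleCell 1≤m 1≤n = record
  { len    = 0
  ; vert   = λ _ → (0 , 0)
  ; inGrid = λ _ → 1≤n , 1≤m
  ; inj    = λ { zero zero _ → refl }
  ; adjIff = λ { zero zero () }
  }

small-grid : ∀ {m n} → m ≤ 6 ⊎ n ≤ 6 → m * n ≤ 12 * (m + n)
small-grid {m} {n} (inj₁ m≤6) = begin
  m * n        ≤⟨ *-monoˡ-≤ n (≤-trans m≤6 (m≤m+n 6 6)) ⟩
  12 * n       ≤⟨ *-monoʳ-≤ 12 (m≤n+m n m) ⟩
  12 * (m + n) ∎
  where open ≤-Reasoning
small-grid {m} {n} (inj₂ n≤6) = begin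
  m * n        ≡⟨ *-comm m n ⟩
  n * m        ≤⟨ *-monoˡ-≤ m (≤-trans n≤6 (m≤m+n 6 6)) ⟩
  12 * m       ≤⟨ *-monoʳ-≤ 12 (m≤m+n m n) ⟩
  12 * (m + n) ∎
  where open ≤-Reasoning

large-or-small : ∀ m n → (7 ≤ m × 7 ≤ n) ⊎ (m ≤ 6 ⊎ n ≤ 6)
large-or-small m n with 7 ≤? m | 7 ≤? n
... | yes 7≤m | yes 7≤n = inj₁ (7≤m , 7≤n)
... | no  7≰m | _       = inj₂ (inj₁ (≤-pred (≰⇒> 7≰m)))
... | yes _   | no  7≰n = inj₂ (inj₂ (≤-pred (≰⇒> 7≰n)))

cycle-length-arith : ∀ {l x s} → 2 ≤ s → 3 * l ≤ x + 3 * s → 3 * (2 + l) ≤ x + 12 * s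
cycle-length-arith {l} {x} {s} 2≤s 3l≤ = begin
  3 * (2 + l)       ≡⟨ *-distribˡ-+ 3 2 l ⟩
  6 + 3 * l         ≤⟨ +-mono-≤ (*-monoʳ-≤ 3 2≤s) 3l≤ ⟩
  3 * s + (x + 3 * s) ≤⟨ +-monoˡ-≤ (x + 3 * s) (*-monoˡ-≤ s (m≤m+n 3 6)) ⟩
  9 * s + (x + 3 * s) ≡⟨ regroup x s ⟩
  x + 12 * s        ∎
  where
  open ≤-Reasoning
  regroup : ∀ x s → 9 * s + (x + 3 * s) ≡ x + 12 * s
  regroup = solve-∀

path-length-arith : ∀ {l x s} → 2 ≤ s → x ≤ 3 * (2 + l) + 9 * s → x ≤ 3 * l + 12 * s
path-length-arith {l} {x} {s} 2≤s x≤ = begin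
  x                     ≤⟨ x≤ ⟩
  3 * (2 + l) + 9 * s   ≡⟨ regroup l s ⟩
  3 * l + (6 + 9 * s)   ≤⟨ +-monoʳ-≤ (3 * l) (+-monoˡ-≤ (9 * s) (*-monoʳ-≤ 3 2≤s)) ⟩
  3 * l + (3 * s + 9 * s) ≡⟨ cong (3 * l +_) (sym (*-distribʳ-+ s 3 9)) ⟩
  3 * l + 12 * s        ∎
  where
  open ≤-Reasoning
  regroup : ∀ l s → 3 * (2 + l) + 9 * s ≡ 3 * l + (6 + 9 * s)
  regroup = solve-∀

path-upperBound : ∀ {m n} (P : SnakePath m n) → 3 * SnakePath.len P ≤ m * n + 12 * (m + n)
path-upperBound {m} {n} P = ≤-trans (PathBound.length-upperBound P) (+-monoʳ-≤ (m * n) (*-monoˡ-≤ (m + n) (m≤m+n 3 9)))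

cycle-upperBound : ∀ {m n} → 2 ≤ m + n → (Q : SnakeCycle m n) → 3 * SnakeCycle.len Q ≤ m * n + 12 * (m + n)
cycle-upperBound {m} {n} 2≤m+n Q with cycle⇒path Q
... | P , len≡ = subst (λ l → 3 * l ≤ m * n + 12 * (m + n)) (sym len≡)
                       (cycle-length-arith {SnakePath.len P} {m * n} 2≤m+n (PathBound.length-upperBound P))

path-lowerBound : ∀ {m n} → 1 ≤ m → 1 ≤ n → Σ[ P ∈ SnakePath m n ] m * n ≤ 3 * SnakePath.len P + 12 * (m + n)
path-lowerBound {m} {n} 1≤m 1≤n with large-or-small m n
... | inj₂ small = singleCell 1≤m 1≤n , small-grid small
... | inj₁ (7≤m , 7≤n) = shorten (large-cycle-lowerBound 7≤m 7≤n)
  where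
  shorten : Σ[ Q ∈ SnakeCycle m n ] m * n ≤ 3 * SnakeCycle.len Q + 9 * (m + n) →
            Σ[ P ∈ SnakePath m n ] m * n ≤ 3 * SnakePath.len P + 12 * (m + n)
  shorten (Q , mn≤) with cycle⇒path Q
  ... | P , len≡ = P , path-length-arith {SnakePath.len P} (+-mono-≤ 1≤m 1≤n) (subst (λ l → m * n ≤ 3 * l + 9 * (m + n)) len≡ mn≤)

cycle-lowerBound : ∀ m n → (Σ[ Q ∈ SnakeCycle m n ] m * n ≤ 3 * SnakeCycle.len Q + 12 * (m + n)) ⊎ m * n ≤ 12 * (m + n)
cycle-lowerBound m n with large-or-small m n
... | inj₂ small = inj₂ (small-grid small)
... | inj₁ (7≤m , 7≤n) = inj₁ (weaken (large-cycle-lowerBound 7≤m 7≤n))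
  where
  weaken : Σ[ Q ∈ SnakeCycle m n ] m * n ≤ 3 * SnakeCycle.len Q + 9 * (m + n) →
           Σ[ Q ∈ SnakeCycle m n ] m * n ≤ 3 * SnakeCycle.len Q + 12 * (m + n)
  weaken (Q , mn≤) = Q , ≤-trans mn≤ (+-monoʳ-≤ (3 * SnakeCycle.len Q) (*-monoˡ-≤ (m + n) (m≤m+n 9 3)))

proposition4 : ∃[ C ] (∀ (m n : ℕ) → 1 ≤ m → 1 ≤ n →
    ((∀ (P : SnakePath m n) → 3 * SnakePath.len P ≤ m * n + C * (m + n))
    × (Σ[ P ∈ SnakePath m n ] (m * n ≤ 3 * SnakePath.len P + C * (m + n))))
    × ((∀ (Q : SnakeCycle m n) → 3 * SnakeCycle.len Q ≤ m * n + C * (m + n))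
    × ((Σ[ Q ∈ SnakeCycle m n ] (m * n ≤ 3 * SnakeCycle.len Q + C * (m + n))) ⊎ (m * n ≤ C * (m + n)))))
proposition4 = 12 , λ m n 1≤m 1≤n →
  (path-upperBound , path-lowerBound 1≤m 1≤n) , (cycle-upperBound (+-mono-≤ 1≤m 1≤n) , cycle-lowerBound m n)
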